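{- For every $n>0$, $$A_n=\sum_{k=0}^{n-1}B^1_{n-k}A_k,$$ where $A_m$ is the number of equivalence classes of ta-diagrams with $m$ arcs (with $A_0=1$) and $B^1_m$ is the number of equivalence classes of ta-diagrams with $m$ arcs and exactly one block.
   Context: An $n$-arcdiagram is a planar diagram of $n$ pairwise non-intersecting semicircles (arcs) in the closed upper half-plane with endpoints on a horizontal line, considered up to isotopy; $a_1,\dots,a_n$ denote the arcs in increasing order of right endpoints. A top arc is an arc not inside any other arc. A ta-diagram is an arcdiagram with finitely many ties, each a simple curve in the open upper half-plane joining two different arcs, meeting no arc except at its endpoints and no other tie. The ta-partition is the partition of the arcs into connected components of the graph whose edges are the ties; two ta-diagrams are equivalent if they have the same underlying arcdiagram and the same ta-partition. Blocks: let $t_1,\dots,t_m$ be the top arcs from left to right; $t_i$ and $t_{i+1}$ belong to the same block if there exist $a\le i<i+1\le c$ with $t_a$ and $t_c$ in the same part of the ta-partition; a block is a maximal run of consecutive top arcs so related, together with all arcs inside them (so a block either has a single top arc or has first and last top arcs in the same part). The empty diagram ($0$ arcs) has $0$ blocks. -}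

module Defs where

open import Data.Bool using (Bool; true; false; T)
open import Data.Nat using (ℕ; zero; suc; _+_; _*_; _∸_; _<_; _≤_; _⊓_; _⊔_)
open import Data.List using (List; []; _∷_; length; take; drop; map; upTo)
open import Data.Nat.ListAction using (sum)
open import Data.List.Relation.Unary.All using (All)
open import Data.List.Relation.Unary.Unique.Propositional using (Unique)
open import Data.List.Membership.Propositional using (_∈_)
open import Data.Maybe using (Maybe; just; nothing)
open import Data.Product using (Σ; ∃; ∃-syntax; _×_; _,_)
open import Data.Sum using (_⊎_)
open import Relation.Nullary using (¬_)
open import Relation.Binary.PropositionalEquality using (_≡_; _≢_)
open import Function.Bundles using (_⇔_)

-- Arcdiagrams up to isotopy = Dyck words (true = left endpoint,
-- false = right endpoint), read left to right along the line.

dyck : ℕ → List Bool → Bool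
dyck zero    []            = true
dyck (suc _) []            = false
dyck h       (true ∷ w)    = dyck (suc h) w
dyck zero    (false ∷ w)   = false
dyck (suc h) (false ∷ w)   = dyck h w

IsDyck : List Bool → Set
IsDyck w = T (dyck 0 w)

IsArcDiagram : ℕ → List Bool → Set
IsArcDiagram n w = (length w ≡ 2 * n) × IsDyck w

data At {A : Set} : List A → ℕ → A → Set where
  here  : ∀ {x xs} → At (x ∷ xs) zero x
  there : ∀ {x xs i y} → At xs i y → At (x ∷ xs) (suc i) y

numClose : List Bool → ℕ
numClose []            = 0
numClose (true ∷ w)    = numClose w
numClose (false ∷ w)   = suc (numClose w)

-- Arc a_{k+1} (0-based index k, arcs ordered by right endpoints) has
-- left endpoint at position l and right endpoint at position r.
Arc : List Bool → ℕ → ℕ → ℕ → Set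
Arc w k l r =
  At w l true × At w r false × l < r
  × IsDyck (take (r ∸ suc l) (drop (suc l) w))
  × numClose (take r w) ≡ k

Inside : List Bool → ℕ → ℕ → Set
Inside w i j = ∃[ l ] ∃[ r ] ∃[ l' ] ∃[ r' ]
  (Arc w i l r × Arc w j l' r' × l' < l × r < r')

-- top arc (to be used only for indices i < n)
Top : List Bool → ℕ → Set
Top w i = ¬ (∃[ j ] Inside w i j)

Parent : List Bool → ℕ → ℕ → Set
Parent w i j = Inside w i j × ¬ (∃[ k ] (Inside w i k × Inside w k j))

ParentM : List Bool → ℕ → Maybe ℕ → Set
ParentM w i nothing  = Top w i
ParentM w i (just j) = Parent w i j

-- Faces (regions of the open upper half-plane minus the arcs):
-- 'nothing' = the outer face, 'just p' = the face just below arc p.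
-- Face w i j f : arcs i and j both lie on the boundary of face f.
Face : List Bool → ℕ → ℕ → Maybe ℕ → Set
Face w i j f =
  (ParentM w i f × ParentM w j f)
  ⊎ (Parent w i j × f ≡ just j)
  ⊎ (Parent w j i × f ≡ just i)

-- Ties, recorded by the pair of arcs they join.

Tie : Set
Tie = ℕ × ℕ

ValidTie : List Bool → ℕ → Tie → Set
ValidTie w n (i , j) = i < n × j < n × i ≢ j × ∃[ f ] Face w i j f

-- strict interleaving of {i,j} and {k,l} in the order of right
-- endpoints (= the cyclic boundary order of every face)
Interleave : Tie → Tie → Set
Interleave (i , j) (k , l) =
  ((i ⊓ j) < (k ⊓ l) × (k ⊓ l) < (i ⊔ j) × (i ⊔ j) < (k ⊔ l))
  ⊎ ((k ⊓ l) < (i ⊓ j) × (i ⊓ j) < (k ⊔ l) × (k ⊔ l) < (i ⊔ j))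

-- two ties are forced to intersect
Cross : List Bool → Tie → Tie → Set
Cross w (i , j) (k , l) =
  ∃[ f ] (Face w i j f × Face w k l f × Interleave (i , j) (k , l))

NonCrossing : List Bool → List Tie → Set
NonCrossing w ts = ∀ {t u} → t ∈ ts → u ∈ ts → ¬ Cross w t u

data Conn (ts : List Tie) : ℕ → ℕ → Set where
  c-refl  : ∀ {i} → Conn ts i i
  c-edge  : ∀ {i j} → (i , j) ∈ ts → Conn ts i j
  c-sym   : ∀ {i j} → Conn ts i j → Conn ts j i
  c-trans : ∀ {i j k} → Conn ts i j → Conn ts j k → Conn ts i k

-- Partitions of the arcs {0,…,n-1}, stored canonically as their
-- n × n "same part" Boolean matrix.

Matrix : Set
Matrix = List (List Bool)

Shape : ℕ → Matrix → Set
Shape n R = (length R ≡ n) × All (λ row → length row ≡ n) R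

SamePart : Matrix → ℕ → ℕ → Set
SamePart R i j = ∃[ row ] (At R i row × At row j true)

TaPartition : ℕ → List Tie → Matrix → Set
TaPartition n ts R = Shape n R ×
  (∀ i j → i < n → j < n → (SamePart R i j ⇔ Conn ts i j))

-- An equivalence class of ta-diagrams with n arcs is the pair
-- (arcdiagram, ta-partition) of some ta-diagram.
TaClass : ℕ → List Bool × Matrix → Set
TaClass n (w , R) = IsArcDiagram n w ×
  ∃[ ts ] (All (ValidTie w n) ts × NonCrossing w ts × TaPartition n ts R)

OneBlock : ℕ → List Bool → Matrix → Set
OneBlock n w R =
  (∃[ k ] (k < n × Top w k))
  × (∀ p q → p < q → q < n → Top w p → Top w q
       → (∀ k → p < k → k < q → ¬ Top w k)
       → ∃[ a ] ∃[ c ] (a ≤ p × q ≤ c × c < n × Top w a × Top w c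
                         × SamePart R a c))

TaClass1 : ℕ → List Bool × Matrix → Set
TaClass1 n (w , R) = TaClass n (w , R) × OneBlock n w R

Card : {A : Set} → (A → Set) → ℕ → Set
Card {A} P N = ∃[ L ] (length L ≡ N × Unique L × (∀ (x : A) → (x ∈ L ⇔ P x)))

convSum : (ℕ → ℕ) → (ℕ → ℕ) → ℕ → ℕ
convSum B A n = sum (map (λ k → B (n ∸ k) * A k) (upTo n))

{-# OPTIONS --safe #-}

-- Call c a block boundary of a ta-diagram if its first 2c letters are balanced and no part
-- contains top arcs on both sides of c. A tie joins two arcs bounding a common face, and the
-- only face with arcs on both sides of such a c is the outer one, whose arcs are the top arcs;
-- so at a block boundary no tie crosses c, and the diagram is the juxtaposition of a ta-diagram
-- on the first c arcs with one on the others, with block-diagonal partition matrix. Conversely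
-- any two ta-diagrams juxtapose to one. The least positive block boundary of a ta-diagram with
-- n > 0 arcs ends its first block, so the diagram is uniquely a one-block diagram with n ∸ k
-- arcs juxtaposed with an arbitrary one with k < n arcs, and summing over k gives the formula.

module Submission where

open import Defs
open import Data.Bool using (Bool; true; false; T)
open import Data.Nat
open import Data.Nat.Properties
open import Data.Nat.Induction using (<-wellFounded)
open import Data.Nat.ListAction using (sum)
open import Data.List using
  (List; []; _∷_; [_]; length; take; drop; map; upTo; _++_; replicate; filter; concat; cartesianProduct)
open import Data.List.Properties
  using (++-assoc; ++-identityʳ; ∷-injective; length-++; length-map; map-∘; map-cong; map-id-local; length-replicate;
    length-take; length-drop; take-all; take++drop≡id)
open import Data.List.Relation.Unary.All using (All; []; _∷_)
import Data.List.Relation.Unary.All as All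
import Data.List.Relation.Unary.All.Properties as All
open import Data.List.Relation.Unary.AllPairs using ([]; _∷_)
import Data.List.Relation.Unary.AllPairs as AllPairs
import Data.List.Relation.Unary.AllPairs.Properties as AllPairs
open import Data.List.Relation.Unary.Unique.Propositional using (Unique)
import Data.List.Relation.Unary.Unique.Propositional.Properties as Unique
open import Data.List.Relation.Binary.Disjoint.Propositional using (Disjoint)
open import Data.List.Relation.Binary.Permutation.Propositional.Properties using (↭-length)
open import Data.List.Relation.Binary.BagAndSetEquality using (∼bag⇒↭)
open import Data.List.Relation.Unary.Any using (here; there)
open import Data.List.Membership.Propositional using (_∈_)
open import Data.List.Membership.Propositional.Properties
open import Data.List.Membership.Propositional.Properties.WithK using (unique∧set⇒bag)
open import Data.Maybe using (Maybe; just; nothing; _>>=_)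
import Data.Maybe as Maybe
import Data.Maybe.Properties as Maybe
open import Data.Product using (∃; ∃₂; _×_; _,_; proj₁; proj₂)
open import Data.Sum using (_⊎_; inj₁; inj₂; [_,_]′)
open import Data.Empty using (⊥; ⊥-elim)
open import Data.Unit using (tt)
open import Function.Base using (_on_; _∘′_; case_of_)
open import Induction.WellFounded using (Acc; acc)
import Relation.Binary.Construct.On as On
open import Relation.Nullary using (¬_; yes; no; Dec)
open import Relation.Nullary.Decidable using (_×-dec_; map′)
open import Relation.Binary.PropositionalEquality hiding ([_])
open import Relation.Binary.Definitions using (tri<; tri≈; tri>)
open import Function.Bundles using (_⇔_; mk⇔; module Equivalence)
open Equivalence using (to; from)

-- Balanced words

height : ℕ → List Bool → Maybe ℕ
height h       []          = just h
height h       (true ∷ w)  = height (suc h) w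
height zero    (false ∷ w) = nothing
height (suc h) (false ∷ w) = height h w

record Balanced (w : List Bool) : Set where
  constructor balanced
  field returns : height 0 w ≡ just 0
open Balanced

dyck⇒height : ∀ h w → T (dyck h w) → height h w ≡ just 0
dyck⇒height zero    []          _ = refl
dyck⇒height zero    (true ∷ w)  d = dyck⇒height 1 w d
dyck⇒height (suc h) (true ∷ w)  d = dyck⇒height (2 + h) w d
dyck⇒height (suc h) (false ∷ w) d = dyck⇒height h w d

height⇒dyck : ∀ h w → height h w ≡ just 0 → T (dyck h w)
height⇒dyck zero    []          _ = tt
height⇒dyck zero    (true ∷ w)  e = height⇒dyck 1 w e
height⇒dyck (suc h) (true ∷ w)  e = height⇒dyck (2 + h) w e
height⇒dyck (suc h) (false ∷ w) e = height⇒dyck h w e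

height-++ : ∀ h x y → height h (x ++ y) ≡ (height h x >>= λ h′ → height h′ y)
height-++ h       []          y = refl
height-++ h       (true ∷ x)  y = height-++ (suc h) x y
height-++ zero    (false ∷ x) y = refl
height-++ (suc h) (false ∷ x) y = height-++ h x y

height-++-just : ∀ {h h′} x y → height h x ≡ just h′ → height h (x ++ y) ≡ height h′ y
height-++-just {h} x y e = trans (height-++ h x y) (cong (_>>= λ h′ → height h′ y) e)

height-++⁻ : ∀ {h m} x y → height h (x ++ y) ≡ just m →
             ∃ λ h′ → height h x ≡ just h′ × height h′ y ≡ just m
height-++⁻ {h} x y e with height h x | height-++ h x y
... | just h′ | eq = h′ , refl , trans (sym eq) e
... | nothing | eq with () ← trans (sym eq) e

height-+ : ∀ k {h h′} x → height h x ≡ just h′ → height (k + h) x ≡ just (k + h′)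
height-+ k         []          refl = refl
height-+ k {h}     (true ∷ x)  e    = trans (cong (λ z → height z x) (sym (+-suc k h))) (height-+ k x e)
height-+ k {suc h} (false ∷ x) e    = trans (cong (λ z → height z (false ∷ x)) (+-suc k h)) (height-+ k x e)

numClose-++ : ∀ x y → numClose (x ++ y) ≡ numClose x + numClose y
numClose-++ []          y = refl
numClose-++ (true ∷ x)  y = numClose-++ x y
numClose-++ (false ∷ x) y = cong suc (numClose-++ x y)

height-length : ∀ {h h′} x → height h x ≡ just h′ → h + length x ≡ h′ + 2 * numClose x
height-length         []          refl = refl
height-length {h}     (true ∷ x)  e    = trans (+-suc h (length x)) (height-length x e)
height-length {suc h} {h′} (false ∷ x) e = begin
  suc h + suc (length x)       ≡⟨ cong suc (+-suc h (length x)) ⟩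
  2 + (h + length x)           ≡⟨ cong (2 +_) (height-length x e) ⟩
  2 + (h′ + 2 * numClose x)    ≡⟨ solve 2 (λ a c → con 2 :+ (a :+ con 2 :* c) := a :+ con 2 :* (con 1 :+ c))
                                        refl h′ (numClose x) ⟩
  h′ + 2 * suc (numClose x)    ∎
  where
  open ≡-Reasoning
  open import Data.Nat.Solver using (module +-*-Solver)
  open +-*-Solver

Balanced-length : ∀ {w} → Balanced w → length w ≡ 2 * numClose w
Balanced-length {w} bw = height-length w (returns bw)

Balanced-++ : ∀ {x y} → Balanced x → Balanced y → Balanced (x ++ y)
Balanced-++ {x} {y} bx by = balanced (trans (height-++-just x y (returns bx)) (returns by))

Balanced-++⁻ʳ : ∀ {x y} → Balanced x → Balanced (x ++ y) → Balanced y
Balanced-++⁻ʳ {x} {y} bx bxy = balanced (trans (sym (height-++-just x y (returns bx))) (returns bxy))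

Balanced-numClose : ∀ {u m} → Balanced u → length u ≡ 2 * m → numClose u ≡ m
Balanced-numClose bu len = *-cancelˡ-≡ _ _ 2 (trans (sym (Balanced-length bu)) len)

Balanced? : ∀ w → Dec (Balanced w)
Balanced? w = map′ balanced returns (Maybe.≡-dec _≟_ (height 0 w) (just 0))

height-descends⇒¬Balanced-++ : ∀ {h} x y → height (suc h) x ≡ just 0 → ¬ Balanced (x ++ y)
height-descends⇒¬Balanced-++ {h} x y descends bxy with height-++⁻ x y (returns bxy)
... | m , from-0 , _ with height-+ (suc h) x from-0
...   | from-suc-h rewrite +-identityʳ h with () ← trans (sym from-suc-h) descends

-- x is the part of w read before the first step from height suc h down to h.
firstReturn : ∀ k {h} w → height (k + suc h) w ≡ just 0 →
              ∃₂ λ x y → w ≡ x ++ false ∷ y × height k x ≡ just 0 × height h y ≡ just 0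
firstReturn zero    []          ()
firstReturn (suc k) []          ()
firstReturn zero    (false ∷ y) e = [] , y , refl , refl , e
firstReturn (suc k) (false ∷ w) e with firstReturn k w e
... | x , y , refl , ex , ey = false ∷ x , y , refl , ex , ey
firstReturn k       (true ∷ w)  e with firstReturn (suc k) w e
... | x , y , refl , ex , ey = true ∷ x , y , refl , ex , ey

wrap : List Bool → List Bool
wrap z = true ∷ z ++ [ false ]

Balanced-wrap : ∀ {z} → Balanced z → Balanced (wrap z)
Balanced-wrap {z} bz = balanced (height-++-just z [ false ] (height-+ 1 z (returns bz)))

numClose-wrap : ∀ z → numClose (wrap z) ≡ suc (numClose z)
numClose-wrap z = trans (numClose-++ z [ false ]) (+-comm (numClose z) 1)

-- Every nonempty balanced word is wrap z ++ v with z, v balanced.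
Balanced-ind : (P : List Bool → Set) → P [] →
               (∀ {z v} → Balanced z → Balanced v → P z → P v → P (wrap z ++ v)) →
               ∀ {w} → Balanced w → P w
Balanced-ind P P[] Pwrap = go _ (On.wellFounded length <-wellFounded _)
  where
  go : ∀ w → Acc (_<_ on length) w → Balanced w → P w
  go []          _        _              = P[]
  go (false ∷ w) _        (balanced ())
  go (true ∷ w)  (acc rs) (balanced bw) with firstReturn 0 w bw
  ... | z , v , refl , bz , bv =
    subst P (cong (true ∷_) (++-assoc z [ false ] v))
      (Pwrap (balanced bz) (balanced bv) (go z (rs shorterˡ) (balanced bz)) (go v (rs shorterʳ) (balanced bv)))
    where
    shorterˡ : length z < length (true ∷ z ++ false ∷ v)
    shorterˡ = s≤s (subst (length z ≤_) (sym (length-++ z)) (m≤m+n _ _))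
    shorterʳ : length v < length (true ∷ z ++ false ∷ v)
    shorterʳ = s≤s (subst (length v ≤_) (sym (length-++ z)) (≤-trans (n≤1+n _) (m≤n+m _ (length z))))

private variable A B : Set

At-++⁺ˡ : ∀ {xs ys : List A} {i y} → At xs i y → At (xs ++ ys) i y
At-++⁺ˡ here      = here
At-++⁺ˡ (there a) = there (At-++⁺ˡ a)

At-++⁺ʳ : ∀ (xs : List A) {ys i y} → At ys i y → At (xs ++ ys) (length xs + i) y
At-++⁺ʳ []       a = a
At-++⁺ʳ (x ∷ xs) a = there (At-++⁺ʳ xs a)

At⇒<length : ∀ {xs : List A} {i y} → At xs i y → i < length xs
At⇒<length here      = z<s
At⇒<length (there a) = s≤s (At⇒<length a)

At-++⁻ : ∀ (xs : List A) {ys i y} → At (xs ++ ys) i y →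
         (i < length xs × At xs i y) ⊎ (∃ λ i′ → i ≡ length xs + i′ × At ys i′ y)
At-++⁻ []       a = inj₂ (_ , refl , a)
At-++⁻ (x ∷ xs) here = inj₁ (z<s , here)
At-++⁻ (x ∷ xs) (there a) with At-++⁻ xs a
... | inj₁ (lt , b)        = inj₁ (s≤s lt , there b)
... | inj₂ (i′ , refl , b) = inj₂ (i′ , refl , b)

At-++⁻ˡ : ∀ (xs : List A) {ys i y} → i < length xs → At (xs ++ ys) i y → At xs i y
At-++⁻ˡ xs lt a with At-++⁻ xs a
... | inj₁ (_ , b)         = b
... | inj₂ (i′ , refl , b) = ⊥-elim (m+n≮m _ _ lt)

At-++⁻ʳ : ∀ (xs : List A) {ys i y} → At (xs ++ ys) (length xs + i) y → At ys i y
At-++⁻ʳ xs {i = i} a with At-++⁻ xs a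
... | inj₁ (lt , _)     = ⊥-elim (m+n≮m _ i lt)
... | inj₂ (i′ , e , b) = subst (λ z → At _ z _) (sym (+-cancelˡ-≡ (length xs) _ _ e)) b

At-functional : ∀ {xs : List A} {i x y} → At xs i x → At xs i y → x ≡ y
At-functional here      here      = refl
At-functional (there a) (there b) = At-functional a b

At-lookup : ∀ (xs : List A) i → (∃ λ x → At xs i x) ⊎ (∀ x → ¬ At xs i x)
At-lookup []       i       = inj₂ (λ x ())
At-lookup (y ∷ ys) zero    = inj₁ (y , here)
At-lookup (y ∷ ys) (suc i) with At-lookup ys i
... | inj₁ (x , a) = inj₁ (x , there a)
... | inj₂ none    = inj₂ (λ { x (there a) → none x a })

At⇒take++∷drop : ∀ {xs : List A} {i x} → At xs i x → xs ≡ take i xs ++ x ∷ drop (suc i) xs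
At⇒take++∷drop here                = refl
At⇒take++∷drop {xs = y ∷ _} (there a) = cong (y ∷_) (At⇒take++∷drop a)

At-take⁻ : ∀ {xs : List A} c {i x} → At (take c xs) i x → i < c × At xs i x
At-take⁻ {xs = y ∷ ys} (suc c) here      = z<s , here
At-take⁻ {xs = y ∷ ys} (suc c) (there a) = let i<c , b = At-take⁻ c a in s≤s i<c , there b

At-take⁺ : ∀ {xs : List A} c {i x} → i < c → At xs i x → At (take c xs) i x
At-take⁺ (suc c) _         here      = here
At-take⁺ (suc c) (s≤s i<c) (there a) = there (At-take⁺ c i<c a)

At-drop⁻ : ∀ {xs : List A} c {i x} → At (drop c xs) i x → At xs (c + i) x
At-drop⁻                zero    a = a
At-drop⁻ {xs = y ∷ ys} (suc c) a = there (At-drop⁻ c a)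

At-map⁺ : ∀ (f : A → B) {xs : List A} {i x} → At xs i x → At (map f xs) i (f x)
At-map⁺ f here      = here
At-map⁺ f (there a) = there (At-map⁺ f a)

At-map⁻ : ∀ {f : A → B} {xs : List A} {i y} → At (map f xs) i y → ∃ λ x → At xs i x × y ≡ f x
At-map⁻ {xs = x ∷ xs} here      = x , here , refl
At-map⁻ {xs = x ∷ xs} (there a) = let z , b , e = At-map⁻ a in z , there b , e

At-All : ∀ {P : A → Set} {xs i x} → All P xs → At xs i x → P x
At-All (p ∷ ps) here      = p
At-All (p ∷ ps) (there a) = At-All ps a

All-At : ∀ {P : A → Set} (xs : List A) → (∀ {i x} → At xs i x → P x) → All P xs
All-At []       f = []
All-At (x ∷ xs) f = f here ∷ All-At xs (f ∘′ there)

¬At-replicate-false : ∀ n {j} → ¬ At (replicate n false) j true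
¬At-replicate-false (suc n) (there a) = ¬At-replicate-false n a

¬At-true⇒replicate-false : ∀ (xs : List Bool) → (∀ {j} → ¬ At xs j true) → xs ≡ replicate (length xs) false
¬At-true⇒replicate-false []           f = refl
¬At-true⇒replicate-false (true ∷ xs)  f = ⊥-elim (f here)
¬At-true⇒replicate-false (false ∷ xs) f = cong (false ∷_) (¬At-true⇒replicate-false xs (f ∘′ there))

take-++ˡ : ∀ m (xs ys : List A) → m ≤ length xs → take m (xs ++ ys) ≡ take m xs
take-++ˡ zero    xs       ys _         = refl
take-++ˡ (suc m) (x ∷ xs) ys (s≤s le) = cong (x ∷_) (take-++ˡ m xs ys le)

take-++ʳ : ∀ m (xs ys : List A) → take (length xs + m) (xs ++ ys) ≡ xs ++ take m ys
take-++ʳ m []       ys = refl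
take-++ʳ m (x ∷ xs) ys = cong (x ∷_) (take-++ʳ m xs ys)

take-length-++ : ∀ (xs ys : List A) → take (length xs) (xs ++ ys) ≡ xs
take-length-++ xs ys = trans (take-++ˡ _ xs ys ≤-refl) (take-all _ xs ≤-refl)

drop-++ˡ : ∀ m (xs ys : List A) → m ≤ length xs → drop m (xs ++ ys) ≡ drop m xs ++ ys
drop-++ˡ zero    xs       ys _         = refl
drop-++ˡ (suc m) (x ∷ xs) ys (s≤s le) = drop-++ˡ m xs ys le

drop-++ʳ : ∀ m (xs ys : List A) → drop (length xs + m) (xs ++ ys) ≡ drop m ys
drop-++ʳ m []       ys = refl
drop-++ʳ m (x ∷ xs) ys = drop-++ʳ m xs ys

drop-length-++ : ∀ (xs ys : List A) → drop (length xs) (xs ++ ys) ≡ ys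
drop-length-++ []       ys = refl
drop-length-++ (x ∷ xs) ys = drop-length-++ xs ys

++-injective : ∀ {xs xs′ ys ys′ : List A} → length xs ≡ length xs′ → xs ++ ys ≡ xs′ ++ ys′ →
               xs ≡ xs′ × ys ≡ ys′
++-injective {xs = []}     {[]}      _   eq = refl , eq
++-injective {xs = x ∷ xs} {x′ ∷ xs′} len eq =
  let x≡x′ , rest = ∷-injective eq ; xs≡xs′ , ys≡ys′ = ++-injective (suc-injective len) rest in
  cong₂ _∷_ x≡x′ xs≡xs′ , ys≡ys′

length-take-≤ : ∀ m (xs : List A) → m ≤ length xs → length (take m xs) ≡ m
length-take-≤ m xs le = trans (length-take m xs) (m≤n⇒m⊓n≡m le)

pred< : ∀ {a} → 0 < a → pred a < a
pred< {suc a} _ = ≤-refl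

pred<⇒≤ : ∀ {a k} → 0 < a → pred a < k → a ≤ k
pred<⇒≤ {suc a} _ lt = lt

-- Arcs of a concatenation

between : ℕ → ℕ → List Bool → List Bool
between l r w = take (r ∸ suc l) (drop (suc l) w)

numClose-take-< : ∀ (w : List Bool) {r r′} → r < r′ → At w r false → numClose (take r w) < numClose (take r′ w)
numClose-take-< (false ∷ w) {zero}  {suc r′} _         here      = z<s
numClose-take-< (true ∷ w)  {suc r} {suc r′} (s≤s lt) (there a) = numClose-take-< w lt a
numClose-take-< (false ∷ w) {suc r} {suc r′} (s≤s lt) (there a) = s≤s (numClose-take-< w lt a)

numClose-take<numClose : ∀ (w : List Bool) {r} → At w r false → numClose (take r w) < numClose w
numClose-take<numClose w {r} a =
  subst (λ z → numClose (take r w) < numClose z) (take-all (length w) w ≤-refl) (numClose-take-< w (At⇒<length a) a)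

Arc⇒index< : ∀ {w k l r} → Arc w k l r → k < numClose w
Arc⇒index< {w} (_ , ar , _ , _ , refl) = numClose-take<numClose w ar

Arc-index-mono : ∀ {w i j l r l′ r′} → Arc w i l r → Arc w j l′ r′ → r < r′ → i < j
Arc-index-mono {w} (_ , ar , _ , _ , refl) (_ , _ , _ , _ , refl) lt = numClose-take-< w lt ar

Inside⇒index< : ∀ {w i j} → Inside w i j → i < numClose w × j < numClose w
Inside⇒index< (_ , _ , _ , _ , A , B , _) = Arc⇒index< A , Arc⇒index< B

Inside⇒< : ∀ {w i j} → Inside w i j → i < j
Inside⇒< (_ , _ , _ , _ , A , B , _ , r<r′) = Arc-index-mono A B r<r′

Shifted : ℕ → (ℕ → ℕ → Set) → ℕ → ℕ → Set
Shifted a P i j = ∃₂ λ i′ j′ → i ≡ a + i′ × j ≡ a + j′ × P i′ j′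

Below : ℕ → (ℕ → ℕ → Set) → ℕ → ℕ → Set
Below c P i j = i < c × j < c × P i j

ShiftedArc : List Bool → List Bool → ℕ → ℕ → ℕ → Set
ShiftedArc u v k l r = ∃ λ k′ → ∃ λ l′ → ∃ λ r′ →
  k ≡ numClose u + k′ × l ≡ length u + l′ × r ≡ length u + r′ × Arc v k′ l′ r′

shiftFace : ℕ → Maybe ℕ → Maybe ℕ
shiftFace a = Maybe.map (a +_)

shiftFace-injective : ∀ a {f g} → shiftFace a f ≡ shiftFace a g → f ≡ g
shiftFace-injective a {nothing} {nothing} _ = refl
shiftFace-injective a {just p}  {just q}  e = cong just (+-cancelˡ-≡ a _ _ (Maybe.just-injective e))

shiftTie : ℕ → Tie → Tie
shiftTie a (i , j) = (a + i , a + j)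

Interleave-shift⁺ : ∀ a {t t′} → Interleave t t′ → Interleave (shiftTie a t) (shiftTie a t′)
Interleave-shift⁺ a {i , j} {k , l} I
  rewrite sym (+-distribˡ-⊓ a i j) | sym (+-distribˡ-⊓ a k l) | sym (+-distribˡ-⊔ a i j) | sym (+-distribˡ-⊔ a k l)
  with I
... | inj₁ (x , y , z) = inj₁ (+-monoʳ-< a x , +-monoʳ-< a y , +-monoʳ-< a z)
... | inj₂ (x , y , z) = inj₂ (+-monoʳ-< a x , +-monoʳ-< a y , +-monoʳ-< a z)

Interleave-shift⁻ : ∀ a {t t′} → Interleave (shiftTie a t) (shiftTie a t′) → Interleave t t′
Interleave-shift⁻ a {i , j} {k , l} I
  rewrite sym (+-distribˡ-⊓ a i j) | sym (+-distribˡ-⊓ a k l) | sym (+-distribˡ-⊔ a i j) | sym (+-distribˡ-⊔ a k l)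
  with I
... | inj₁ (x , y , z) = inj₁ (+-cancelˡ-< a _ _ x , +-cancelˡ-< a _ _ y , +-cancelˡ-< a _ _ z)
... | inj₂ (x , y , z) = inj₂ (+-cancelˡ-< a _ _ x , +-cancelˡ-< a _ _ y , +-cancelˡ-< a _ _ z)

¬Interleave-separated : ∀ {i j k l c} → i < c → j < c → c ≤ k → c ≤ l →
                        ¬ Interleave (i , j) (k , l) × ¬ Interleave (k , l) (i , j)
¬Interleave-separated {i} {j} {k} {l} i<c j<c c≤k c≤l = left , right
  where
  max<min : i ⊔ j < k ⊓ l
  max<min = <-≤-trans (⊔-pres-<m i<c j<c) (⊓-glb c≤k c≤l)
  min<min : i ⊓ j < k ⊓ l
  min<min = ≤-<-trans (m⊓n≤m⊔n i j) max<min
  left : ¬ Interleave (i , j) (k , l)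
  left (inj₁ (_ , y , _)) = <-asym y max<min
  left (inj₂ (x , _ , _)) = <-asym x min<min
  right : ¬ Interleave (k , l) (i , j)
  right (inj₁ (x , _ , _)) = <-asym x min<min
  right (inj₂ (_ , y , _)) = <-asym y max<min

SameSide : ℕ → ℕ → ℕ → Set
SameSide a i j = (i < a × j < a) ⊎ (a ≤ i × a ≤ j)

SameSide-sym : ∀ {a i j} → SameSide a i j → SameSide a j i
SameSide-sym (inj₁ (i<a , j<a)) = inj₁ (j<a , i<a)
SameSide-sym (inj₂ (a≤i , a≤j)) = inj₂ (a≤j , a≤i)

SameSide-trans : ∀ {a i j k} → SameSide a i j → SameSide a j k → SameSide a i k
SameSide-trans (inj₁ (i<a , _))   (inj₁ (_ , k<a))   = inj₁ (i<a , k<a)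
SameSide-trans (inj₂ (a≤i , _))   (inj₂ (_ , a≤k))   = inj₂ (a≤i , a≤k)
SameSide-trans (inj₁ (_ , j<a))   (inj₂ (a≤j , _))   = ⊥-elim (<⇒≱ j<a a≤j)
SameSide-trans (inj₂ (_ , a≤j))   (inj₁ (j<a , _))   = ⊥-elim (<⇒≱ j<a a≤j)

AllArcs : List Bool → Set
AllArcs w = ∀ {k} → k < numClose w → ∃₂ λ l r → Arc w k l r

TopPrefix : List Bool → Set
TopPrefix w = ∀ {e} → e < numClose w → Top w e → Balanced (take (2 * suc e) w)

module Concatenation (u v : List Bool) where

  between-++ˡ : ∀ {l r} → r < length u → l < r → between l r (u ++ v) ≡ between l r u
  between-++ˡ {l} {r} r<u l<r = begin
    take (r ∸ suc l) (drop (suc l) (u ++ v))   ≡⟨ cong (take (r ∸ suc l)) (drop-++ˡ (suc l) u v (<-trans l<r r<u)) ⟩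
    take (r ∸ suc l) (drop (suc l) u ++ v)     ≡⟨ take-++ˡ (r ∸ suc l) (drop (suc l) u) v fits ⟩
    take (r ∸ suc l) (drop (suc l) u)          ∎
    where
    open ≡-Reasoning
    fits : r ∸ suc l ≤ length (drop (suc l) u)
    fits = subst (r ∸ suc l ≤_) (sym (length-drop (suc l) u)) (∸-monoˡ-≤ (suc l) (<⇒≤ r<u))

  between-++ʳ : ∀ l r → between (length u + l) (length u + r) (u ++ v) ≡ between l r v
  between-++ʳ l r = begin
    take (length u + r ∸ suc (length u + l)) (drop (suc (length u + l)) (u ++ v))
      ≡⟨ cong₂ (λ a b → take (length u + r ∸ a) (drop b (u ++ v))) s s ⟩
    take (length u + r ∸ (length u + suc l)) (drop (length u + suc l) (u ++ v))
      ≡⟨ cong₂ take ([m+n]∸[m+o]≡n∸o (length u) r (suc l)) (drop-++ʳ (suc l) u v) ⟩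
    take (r ∸ suc l) (drop (suc l) v) ∎
    where
    open ≡-Reasoning
    s = sym (+-suc (length u) l)

  numClose-take-++ʳ : ∀ r → numClose (take (length u + r) (u ++ v)) ≡ numClose u + numClose (take r v)
  numClose-take-++ʳ r = trans (cong numClose (take-++ʳ r u v)) (numClose-++ u (take r v))

  Arc-++⁺ˡ : ∀ {k l r} → Arc u k l r → Arc (u ++ v) k l r
  Arc-++⁺ˡ (al , ar , l<r , inner , refl) =
    At-++⁺ˡ al , At-++⁺ˡ ar , l<r ,
    subst IsDyck (sym (between-++ˡ (At⇒<length ar) l<r)) inner ,
    cong numClose (take-++ˡ _ u v (<⇒≤ (At⇒<length ar)))

  Arc-++⁺ʳ : ∀ {k l r} → Arc v k l r → Arc (u ++ v) (numClose u + k) (length u + l) (length u + r)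
  Arc-++⁺ʳ {l = l} {r} (al , ar , l<r , inner , refl) =
    At-++⁺ʳ u al , At-++⁺ʳ u ar , +-monoʳ-< (length u) l<r ,
    subst IsDyck (sym (between-++ʳ l r)) inner , numClose-take-++ʳ r

  Inside-++⁺ˡ : ∀ {i j} → Inside u i j → Inside (u ++ v) i j
  Inside-++⁺ˡ (l , r , l′ , r′ , A , B , x , y) = l , r , l′ , r′ , Arc-++⁺ˡ A , Arc-++⁺ˡ B , x , y

  Inside-++⁺ʳ : ∀ {i j} → Inside v i j → Inside (u ++ v) (numClose u + i) (numClose u + j)
  Inside-++⁺ʳ (_ , _ , _ , _ , A , B , x , y) =
    _ , _ , _ , _ , Arc-++⁺ʳ A , Arc-++⁺ʳ B , +-monoʳ-< (length u) x , +-monoʳ-< (length u) y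

  Top-++⁻ˡ : ∀ {i} → Top (u ++ v) i → Top u i
  Top-++⁻ˡ t (j , I) = t (j , Inside-++⁺ˡ I)

  Top-++⁻ʳ : ∀ {i} → Top (u ++ v) (numClose u + i) → Top v i
  Top-++⁻ʳ t (j , I) = t (numClose u + j , Inside-++⁺ʳ I)

  index-++-split : ∀ {k} → k < numClose (u ++ v) →
                   k < numClose u ⊎ ∃ λ k′ → k ≡ numClose u + k′ × k′ < numClose v
  index-++-split {k} k< with k <? numClose u
  ... | yes k<u = inj₁ k<u
  ... | no k≮u  = inj₂ (k ∸ numClose u , sym k-eq ,
    +-cancelˡ-< (numClose u) _ _ (subst₂ _<_ (sym k-eq) (numClose-++ u v) k<))
    where
    k-eq = m+[n∸m]≡n (≮⇒≥ k≮u)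

  module _ (bu : Balanced u) where

    -- The part of u after an opening position l ends one level below where it starts,
    -- which no prefix of a balanced segment does.
    no-arc-straddles : ∀ {l r} → At (u ++ v) l true → l < length u → length u ≤ r →
                       ¬ IsDyck (between l r (u ++ v))
    no-arc-straddles {l} {r} al l<u u≤r inner =
      height-descends⇒¬Balanced-++ rest (take (r ∸ suc l ∸ length rest) v) rest-descends
        (subst Balanced segment-split (balanced (dyck⇒height 0 (between l r (u ++ v)) inner)))
      where
      rest = drop (suc l) u
      rest-descends : height (suc _) rest ≡ just 0
      rest-descends = proj₂ (proj₂ (height-++⁻ (take l u) (true ∷ rest)
        (returns (subst Balanced (At⇒take++∷drop (At-++⁻ˡ u l<u al)) bu))))
      rest-fits : length rest ≤ r ∸ suc l
      rest-fits = subst (_≤ r ∸ suc l) (sym (length-drop (suc l) u)) (∸-monoˡ-≤ (suc l) u≤r)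
      segment-split : between l r (u ++ v) ≡ rest ++ take (r ∸ suc l ∸ length rest) v
      segment-split = begin
        take (r ∸ suc l) (drop (suc l) (u ++ v))
          ≡⟨ cong (take (r ∸ suc l)) (drop-++ˡ (suc l) u v l<u) ⟩
        take (r ∸ suc l) (rest ++ v)
          ≡⟨ cong (λ m → take m (rest ++ v)) (sym (m+[n∸m]≡n rest-fits)) ⟩
        take (length rest + (r ∸ suc l ∸ length rest)) (rest ++ v)
          ≡⟨ take-++ʳ _ rest v ⟩
        rest ++ take (r ∸ suc l ∸ length rest) v                    ∎
        where open ≡-Reasoning

    Arc-++⁻ : ∀ {k l r} → Arc (u ++ v) k l r → Arc u k l r ⊎ ShiftedArc u v k l r
    Arc-++⁻ {k} {l} {r} (al , ar , l<r , inner , refl) with r <? length u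
    ... | yes r<u = inj₁ (At-++⁻ˡ u (<-trans l<r r<u) al , At-++⁻ˡ u r<u ar , l<r ,
                          subst IsDyck (between-++ˡ r<u l<r) inner ,
                          sym (cong numClose (take-++ˡ r u v (<⇒≤ r<u))))
    ... | no r≮u with l <? length u
    ...   | yes l<u = ⊥-elim (no-arc-straddles al l<u (≮⇒≥ r≮u) inner)
    ...   | no l≮u = inj₂ (numClose (take r′ v) , l′ , r′ , k-eq , sym el , sym er , arc)
      where
      L = length u
      l′ = l ∸ L
      r′ = r ∸ L
      el : L + l′ ≡ l
      el = m+[n∸m]≡n (≮⇒≥ l≮u)
      er : L + r′ ≡ r
      er = m+[n∸m]≡n (≮⇒≥ r≮u)
      k-eq : numClose (take r (u ++ v)) ≡ numClose u + numClose (take r′ v)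
      k-eq = trans (cong (λ z → numClose (take z (u ++ v))) (sym er)) (numClose-take-++ʳ r′)
      arc : Arc v (numClose (take r′ v)) l′ r′
      arc = At-++⁻ʳ u (subst (λ z → At (u ++ v) z true) (sym el) al) ,
            At-++⁻ʳ u (subst (λ z → At (u ++ v) z false) (sym er) ar) ,
            +-cancelˡ-< L _ _ (subst₂ _<_ (sym el) (sym er) l<r) ,
            subst IsDyck (between-++ʳ l′ r′) (subst₂ (λ a b → IsDyck (between a b (u ++ v))) (sym el) (sym er) inner) ,
            refl

    Inside-++⁻ : ∀ {i j} → Inside (u ++ v) i j → Inside u i j ⊎ Shifted (numClose u) (Inside v) i j
    Inside-++⁻ (l , r , l′ , r′ , A , B , x , y) with Arc-++⁻ A | Arc-++⁻ B
    ... | inj₁ A′ | inj₁ B′ = inj₁ (l , r , l′ , r′ , A′ , B′ , x , y)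
    ... | inj₂ (k₁ , l₁ , r₁ , refl , refl , refl , A′) | inj₂ (k₂ , l₂ , r₂ , refl , refl , refl , B′) =
      inj₂ (k₁ , k₂ , refl , refl , l₁ , r₁ , l₂ , r₂ , A′ , B′ ,
            +-cancelˡ-< (length u) _ _ x , +-cancelˡ-< (length u) _ _ y)
    ... | inj₁ (_ , ar , l<r , _) | inj₂ (_ , _ , _ , refl , refl , refl , _) =
      ⊥-elim (m+n≮m _ _ (<-trans x (<-trans l<r (At⇒<length ar))))
    ... | inj₂ (_ , _ , _ , refl , refl , refl , (_ , _ , l<r , _)) | inj₁ (_ , ar′ , _) =
      ⊥-elim (m+n≮m _ _ (<-trans (+-monoʳ-< (length u) l<r) (<-trans y (At⇒<length ar′))))

    Inside-++-side : ∀ {i j} → Inside (u ++ v) i j → SameSide (numClose u) i j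
    Inside-++-side I with Inside-++⁻ I
    ... | inj₁ I′                         = inj₁ (Inside⇒index< I′)
    ... | inj₂ (_ , _ , refl , refl , _) = inj₂ (m≤m+n _ _ , m≤m+n _ _)

    Top-++⁺ˡ : ∀ {i} → i < numClose u → Top u i → Top (u ++ v) i
    Top-++⁺ˡ i<u t (j , I) with Inside-++⁻ I
    ... | inj₁ I′                         = t (j , I′)
    ... | inj₂ (_ , _ , refl , refl , _) = m+n≮m _ _ i<u

    Top-++⁺ʳ : ∀ {i} → Top v i → Top (u ++ v) (numClose u + i)
    Top-++⁺ʳ t (j , I) with Inside-++⁻ I
    ... | inj₁ I′                         = m+n≮m _ _ (proj₁ (Inside⇒index< I′))
    ... | inj₂ (_ , j′ , e , refl , I′) = t (j′ , subst (λ z → Inside v z j′) (sym (+-cancelˡ-≡ _ _ _ e)) I′)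

    Parent-++⁺ˡ : ∀ {i j} → Parent u i j → Parent (u ++ v) i j
    Parent-++⁺ˡ (I , direct) = Inside-++⁺ˡ I , λ (k , I₁ , I₂) → between-arcs k I₁ I₂
      where
      between-arcs : ∀ k → Inside (u ++ v) _ k → Inside (u ++ v) k _ → ⊥
      between-arcs k I₁ I₂ with Inside-++⁻ I₁ | Inside-++⁻ I₂
      ... | inj₂ (_ , _ , refl , refl , _) | _       = m+n≮m _ _ (proj₁ (Inside⇒index< I))
      ... | inj₁ I₁′ | inj₂ (_ , _ , refl , refl , _) = m+n≮m _ _ (proj₂ (Inside⇒index< I₁′))
      ... | inj₁ I₁′ | inj₁ I₂′                       = direct (k , I₁′ , I₂′)

    Parent-++⁺ʳ : ∀ {i j} → Parent v i j → Parent (u ++ v) (numClose u + i) (numClose u + j)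
    Parent-++⁺ʳ {i} {j} (I , direct) = Inside-++⁺ʳ I , λ (k , I₁ , I₂) → between-arcs k I₁ I₂
      where
      between-arcs : ∀ k → Inside (u ++ v) (numClose u + i) k → Inside (u ++ v) k (numClose u + j) → ⊥
      between-arcs k I₁ I₂ with Inside-++⁻ I₁ | Inside-++⁻ I₂
      ... | inj₁ I₁′ | _       = m+n≮m _ _ (proj₁ (Inside⇒index< I₁′))
      ... | inj₂ _   | inj₁ I₂′ = m+n≮m _ _ (proj₂ (Inside⇒index< I₂′))
      ... | inj₂ (_ , k′ , e₁ , refl , I₁′) | inj₂ (k″ , _ , e₂ , e₃ , I₂′) =
        direct (k′ , subst (λ z → Inside v z k′) (sym (+-cancelˡ-≡ _ _ _ e₁)) I₁′ ,
                     subst₂ (Inside v) (sym (+-cancelˡ-≡ _ _ _ e₂)) (sym (+-cancelˡ-≡ _ _ _ e₃)) I₂′)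

    Parent-++⁻ : ∀ {i j} → Parent (u ++ v) i j → Parent u i j ⊎ Shifted (numClose u) (Parent v) i j
    Parent-++⁻ (I , direct) with Inside-++⁻ I
    ... | inj₁ I′ = inj₁ (I′ , λ (k , I₁ , I₂) → direct (k , Inside-++⁺ˡ I₁ , Inside-++⁺ˡ I₂))
    ... | inj₂ (i′ , j′ , refl , refl , I′) =
      inj₂ (i′ , j′ , refl , refl , I′ ,
            λ (k , I₁ , I₂) → direct (numClose u + k , Inside-++⁺ʳ I₁ , Inside-++⁺ʳ I₂))

    ParentM-++⁺ˡ : ∀ {i} f → i < numClose u → ParentM u i f → ParentM (u ++ v) i f
    ParentM-++⁺ˡ nothing  i<u t = Top-++⁺ˡ i<u t
    ParentM-++⁺ˡ (just p) _   P = Parent-++⁺ˡ P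

    ParentM-++⁺ʳ : ∀ {i} f → ParentM v i f → ParentM (u ++ v) (numClose u + i) (shiftFace (numClose u) f)
    ParentM-++⁺ʳ nothing  t = Top-++⁺ʳ t
    ParentM-++⁺ʳ (just p) P = Parent-++⁺ʳ P

    ParentM-++⁻ˡ : ∀ {i} f → i < numClose u → ParentM (u ++ v) i f → ParentM u i f
    ParentM-++⁻ˡ nothing  _   t = Top-++⁻ˡ t
    ParentM-++⁻ˡ (just p) i<u P with Parent-++⁻ P
    ... | inj₁ P′                         = P′
    ... | inj₂ (_ , _ , refl , refl , _) = ⊥-elim (m+n≮m _ _ i<u)

    ParentM-++⁻ʳ : ∀ {i} f → ParentM (u ++ v) (numClose u + i) f →
                   ∃ λ f′ → f ≡ shiftFace (numClose u) f′ × ParentM v i f′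
    ParentM-++⁻ʳ nothing  t = nothing , refl , Top-++⁻ʳ t
    ParentM-++⁻ʳ (just p) P with Parent-++⁻ P
    ... | inj₁ P′ = ⊥-elim (m+n≮m _ _ (proj₁ (Inside⇒index< (proj₁ P′))))
    ... | inj₂ (_ , p′ , e , refl , P′) =
      just p′ , refl , subst (λ z → Parent v z p′) (sym (+-cancelˡ-≡ _ _ _ e)) P′

    Face-++⁺ˡ : ∀ {i j f} → i < numClose u → j < numClose u → Face u i j f → Face (u ++ v) i j f
    Face-++⁺ˡ {f = f} i<u j<u (inj₁ (Pi , Pj))  = inj₁ (ParentM-++⁺ˡ f i<u Pi , ParentM-++⁺ˡ f j<u Pj)
    Face-++⁺ˡ         _   _   (inj₂ (inj₁ (P , e))) = inj₂ (inj₁ (Parent-++⁺ˡ P , e))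
    Face-++⁺ˡ         _   _   (inj₂ (inj₂ (P , e))) = inj₂ (inj₂ (Parent-++⁺ˡ P , e))

    Face-++⁻ˡ : ∀ {i j f} → i < numClose u → j < numClose u → Face (u ++ v) i j f → Face u i j f
    Face-++⁻ˡ {f = f} i<u j<u (inj₁ (Pi , Pj)) = inj₁ (ParentM-++⁻ˡ f i<u Pi , ParentM-++⁻ˡ f j<u Pj)
    Face-++⁻ˡ i<u j<u (inj₂ (inj₁ (P , e))) = inj₂ (inj₁ (ParentM-++⁻ˡ (just _) i<u P , e))
    Face-++⁻ˡ i<u j<u (inj₂ (inj₂ (P , e))) = inj₂ (inj₂ (ParentM-++⁻ˡ (just _) j<u P , e))

    Face-++⁺ʳ : ∀ {i j f} → Face v i j f →
                Face (u ++ v) (numClose u + i) (numClose u + j) (shiftFace (numClose u) f)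
    Face-++⁺ʳ {f = f} (inj₁ (Pi , Pj))        = inj₁ (ParentM-++⁺ʳ f Pi , ParentM-++⁺ʳ f Pj)
    Face-++⁺ʳ         (inj₂ (inj₁ (P , refl))) = inj₂ (inj₁ (Parent-++⁺ʳ P , refl))
    Face-++⁺ʳ         (inj₂ (inj₂ (P , refl))) = inj₂ (inj₂ (Parent-++⁺ʳ P , refl))

    Face-++⁻ʳ : ∀ {i j f} → Face (u ++ v) (numClose u + i) (numClose u + j) f →
                ∃ λ f′ → f ≡ shiftFace (numClose u) f′ × Face v i j f′
    Face-++⁻ʳ {i} {j} {f} (inj₁ (Pi , Pj)) with ParentM-++⁻ʳ f Pi | ParentM-++⁻ʳ f Pj
    ... | f₁ , e₁ , Pi′ | f₂ , e₂ , Pj′ =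
      f₁ , e₁ , inj₁ (Pi′ , subst (ParentM v j) (shiftFace-injective _ (trans (sym e₂) e₁)) Pj′)
    Face-++⁻ʳ (inj₂ (inj₁ (P , refl))) with Parent-++⁻ P
    ... | inj₁ P′ = ⊥-elim (m+n≮m _ _ (proj₁ (Inside⇒index< (proj₁ P′))))
    ... | inj₂ (_ , _ , e₁ , e₂ , P′) =
      just _ , refl ,
      inj₂ (inj₁ (subst₂ (Parent v) (sym (+-cancelˡ-≡ _ _ _ e₁)) (sym (+-cancelˡ-≡ _ _ _ e₂)) P′ , refl))
    Face-++⁻ʳ (inj₂ (inj₂ (P , refl))) with Parent-++⁻ P
    ... | inj₁ P′ = ⊥-elim (m+n≮m _ _ (proj₁ (Inside⇒index< (proj₁ P′))))
    ... | inj₂ (_ , _ , e₁ , e₂ , P′) =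
      just _ , refl ,
      inj₂ (inj₂ (subst₂ (Parent v) (sym (+-cancelˡ-≡ _ _ _ e₁)) (sym (+-cancelˡ-≡ _ _ _ e₂)) P′ , refl))

    ValidTie-++⁺ˡ : ∀ {n i j} → numClose u ≤ n → ValidTie u (numClose u) (i , j) → ValidTie (u ++ v) n (i , j)
    ValidTie-++⁺ˡ u≤n (i<u , j<u , i≢j , f , F) =
      <-≤-trans i<u u≤n , <-≤-trans j<u u≤n , i≢j , f , Face-++⁺ˡ i<u j<u F

    ValidTie-++⁻ˡ : ∀ {n i j} → i < numClose u → j < numClose u → ValidTie (u ++ v) n (i , j) →
      ValidTie u (numClose u) (i , j)
    ValidTie-++⁻ˡ i<u j<u (_ , _ , i≢j , f , F) = i<u , j<u , i≢j , f , Face-++⁻ˡ i<u j<u F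

    ValidTie-++⁺ʳ : ∀ {b t} → ValidTie v b t → ValidTie (u ++ v) (numClose u + b) (shiftTie (numClose u) t)
    ValidTie-++⁺ʳ (i<b , j<b , i≢j , f , F) =
      +-monoʳ-< _ i<b , +-monoʳ-< _ j<b , i≢j ∘′ +-cancelˡ-≡ _ _ _ , shiftFace (numClose u) f , Face-++⁺ʳ F

    ValidTie-++⁻ʳ : ∀ {b t} → ValidTie (u ++ v) (numClose u + b) (shiftTie (numClose u) t) → ValidTie v b t
    ValidTie-++⁻ʳ (i<b , j<b , i≢j , _ , F) =
      +-cancelˡ-< _ _ _ i<b , +-cancelˡ-< _ _ _ j<b , i≢j ∘′ cong (numClose u +_) , proj₁ (Face-++⁻ʳ F) ,
        proj₂ (proj₂ (Face-++⁻ʳ F))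

    Cross-++⁺ˡ : ∀ {i j k l} → i < numClose u → j < numClose u → k < numClose u → l < numClose u →
                 Cross u (i , j) (k , l) → Cross (u ++ v) (i , j) (k , l)
    Cross-++⁺ˡ i<u j<u k<u l<u (f , F₁ , F₂ , I) = f , Face-++⁺ˡ i<u j<u F₁ , Face-++⁺ˡ k<u l<u F₂ , I

    Cross-++⁻ˡ : ∀ {i j k l} → i < numClose u → j < numClose u → k < numClose u → l < numClose u →
                 Cross (u ++ v) (i , j) (k , l) → Cross u (i , j) (k , l)
    Cross-++⁻ˡ i<u j<u k<u l<u (f , F₁ , F₂ , I) = f , Face-++⁻ˡ i<u j<u F₁ , Face-++⁻ˡ k<u l<u F₂ , I

    Cross-++⁺ʳ : ∀ {t t′} → Cross v t t′ → Cross (u ++ v) (shiftTie (numClose u) t) (shiftTie (numClose u) t′)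
    Cross-++⁺ʳ (f , F₁ , F₂ , I) =
      shiftFace (numClose u) f , Face-++⁺ʳ F₁ , Face-++⁺ʳ F₂ , Interleave-shift⁺ _ I

    Cross-++⁻ʳ : ∀ {t t′} → Cross (u ++ v) (shiftTie (numClose u) t) (shiftTie (numClose u) t′) → Cross v t t′
    Cross-++⁻ʳ {k , l} (f , F₁ , F₂ , I) with Face-++⁻ʳ F₁ | Face-++⁻ʳ F₂
    ... | f₁ , e₁ , F₁′ | f₂ , e₂ , F₂′ =
      f₁ , F₁′ , subst (Face v _ _) (shiftFace-injective _ (trans (sym e₂) e₁)) F₂′ , Interleave-shift⁻ _ I

    Balanced-take-++ʳ : ∀ m → take (2 * numClose u + m) (u ++ v) ≡ u ++ take m v
    Balanced-take-++ʳ m = subst (λ z → take (z + m) (u ++ v) ≡ u ++ take m v) (Balanced-length bu) (take-++ʳ m u v)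

    Top-++-last : ∀ {a} → numClose u ≡ a → 0 < a → Top (u ++ v) (pred a)
    Top-++-last refl 0<u = Top-++⁺ˡ (pred< 0<u) λ (j , I) →
      <⇒≱ (proj₂ (Inside⇒index< I)) (pred<⇒≤ 0<u (Inside⇒< I))

    TopPrefix-++ : TopPrefix u → TopPrefix v → TopPrefix (u ++ v)
    TopPrefix-++ prefix-u prefix-v e< top with index-++-split e<
    ... | inj₁ e<u = subst Balanced (sym (take-++ˡ _ u v fits)) (prefix-u e<u (Top-++⁻ˡ top))
      where
      fits = subst (2 * suc _ ≤_) (sym (Balanced-length bu)) (*-monoʳ-≤ 2 e<u)
    ... | inj₂ (e′ , refl , e′<v) = subst Balanced (sym take-eq) (Balanced-++ bu (prefix-v e′<v (Top-++⁻ʳ top)))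
      where
      take-eq : take (2 * suc (numClose u + e′)) (u ++ v) ≡ u ++ take (2 * suc e′) v
      take-eq = begin
        take (2 * suc (numClose u + e′)) (u ++ v)
          ≡⟨ cong (λ z → take (2 * z) (u ++ v)) (sym (+-suc _ e′)) ⟩
        take (2 * (numClose u + suc e′)) (u ++ v)
          ≡⟨ cong (λ z → take z (u ++ v)) (*-distribˡ-+ 2 (numClose u) (suc e′)) ⟩
        take (2 * numClose u + 2 * suc e′) (u ++ v)
          ≡⟨ Balanced-take-++ʳ (2 * suc e′) ⟩
        u ++ take (2 * suc e′) v                    ∎
        where open ≡-Reasoning

  AllArcs-++ : AllArcs u → AllArcs v → AllArcs (u ++ v)
  AllArcs-++ arcs-u arcs-v k< with index-++-split k<
  ... | inj₁ k<u                = let l , r , A = arcs-u k<u in l , r , Arc-++⁺ˡ A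
  ... | inj₂ (k′ , refl , k′<v) = let l , r , A = arcs-v k′<v in length u + l , length u + r , Arc-++⁺ʳ A

Arc-wrap-outer : ∀ {z} → Balanced z → Arc (wrap z) (numClose z) 0 (suc (length z))
Arc-wrap-outer {z} bz =
  here , there (subst (λ i → At (z ++ [ false ]) i false) (+-identityʳ _) (At-++⁺ʳ z here)) , z<s ,
  subst IsDyck (sym (take-length-++ z _)) (height⇒dyck 0 z (returns bz)) ,
  cong numClose (take-length-++ z _)

Arc-wrap-inner : ∀ {z k l r} → Arc z k l r → Arc (wrap z) k (suc l) (suc r)
Arc-wrap-inner {z} A = Concatenation.Arc-++⁺ˡ (true ∷ z) [ false ] (Concatenation.Arc-++⁺ʳ [ true ] z A)

Inside-wrap : ∀ {z k l r} → Balanced z → Arc z k l r → Inside (wrap z) k (numClose z)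
Inside-wrap bz A@(_ , ar , _) = _ , _ , _ , _ , Arc-wrap-inner A , Arc-wrap-outer bz , z<s , s≤s (At⇒<length ar)

AllArcs-wrap : ∀ {z} → Balanced z → AllArcs z → AllArcs (wrap z)
AllArcs-wrap {z} bz arcs {k} k< with m≤n⇒m<n∨m≡n (s≤s⁻¹ (subst (k <_) (numClose-wrap z) k<))
... | inj₁ k<z  = let _ , _ , A = arcs k<z in _ , _ , Arc-wrap-inner A
... | inj₂ refl = _ , _ , Arc-wrap-outer bz

Balanced⇒AllArcs : ∀ {w} → Balanced w → AllArcs w
Balanced⇒AllArcs = Balanced-ind AllArcs (λ ())
  (λ {z} {v} bz _ arcs-z arcs-v → Concatenation.AllArcs-++ (wrap z) v (AllArcs-wrap bz arcs-z) arcs-v)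

TopPrefix-wrap : ∀ {z} → Balanced z → TopPrefix (wrap z)
TopPrefix-wrap {z} bz {e} e< top with m≤n⇒m<n∨m≡n (s≤s⁻¹ (subst (e <_) (numClose-wrap z) e<))
... | inj₁ e<z  = let _ , _ , A = Balanced⇒AllArcs bz e<z in ⊥-elim (top (_ , Inside-wrap bz A))
... | inj₂ refl = subst Balanced (sym (take-all _ (wrap z) (≤-reflexive whole))) (Balanced-wrap bz)
  where
  whole : length (wrap z) ≡ 2 * suc (numClose z)
  whole = trans (Balanced-length (Balanced-wrap bz)) (cong (2 *_) (numClose-wrap z))

Balanced⇒TopPrefix : ∀ {w} → Balanced w → TopPrefix w
Balanced⇒TopPrefix = Balanced-ind TopPrefix (λ ())
  (λ {z} {v} bz _ _ prefix-v → Concatenation.TopPrefix-++ (wrap z) v (Balanced-wrap bz) (TopPrefix-wrap bz) prefix-v)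

Balanced-prefix⇒Top : ∀ {w e} → e < numClose w → Balanced w → Balanced (take (2 * suc e) w) → Top w e
Balanced-prefix⇒Top {w} {e} e<w bw bu =
  subst (λ w → Top w e) (take++drop≡id (2 * suc e) w)
    (Concatenation.Top-++-last (take (2 * suc e) w) (drop (2 * suc e) w) bu
      (Balanced-numClose bu (length-take-≤ _ w (subst (2 * suc e ≤_) (sym (Balanced-length bw)) (*-monoʳ-≤ 2 e<w))))
      z<s)

Top? : ∀ {w e} → Balanced w → e < numClose w → Dec (Top w e)
Top? {w} {e} bw e<w with Balanced? (take (2 * suc e) w)
... | yes prefix = yes (Balanced-prefix⇒Top e<w bw prefix)
... | no ¬prefix = no (¬prefix ∘′ Balanced⇒TopPrefix bw e<w)

Top-last : ∀ {w a} → Balanced w → numClose w ≡ a → 0 < a → Top w (pred a)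
Top-last {w} {a} bw w-arcs 0<a =
  subst (λ w′ → Top w′ (pred a)) (++-identityʳ w) (Concatenation.Top-++-last w [] bw w-arcs 0<a)

Conn-mono : ∀ {ts ts′ : List Tie} {i j} → (∀ {t} → t ∈ ts → t ∈ ts′) → Conn ts i j → Conn ts′ i j
Conn-mono f c-refl        = c-refl
Conn-mono f (c-edge e)    = c-edge (f e)
Conn-mono f (c-sym c)     = c-sym (Conn-mono f c)
Conn-mono f (c-trans c d) = c-trans (Conn-mono f c) (Conn-mono f d)

Conn-shift : ∀ a {ts : List Tie} {i j} → Conn ts i j → Conn (map (shiftTie a) ts) (a + i) (a + j)
Conn-shift a c-refl        = c-refl
Conn-shift a (c-edge e)    = c-edge (∈-map⁺ (shiftTie a) e)
Conn-shift a (c-sym c)     = c-sym (Conn-shift a c)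
Conn-shift a (c-trans c d) = c-trans (Conn-shift a c) (Conn-shift a d)

SplitsAt : ℕ → List Tie → List Tie → List Tie → Set
SplitsAt c ts ts₁ ts₂ = ∀ {i j} → (i , j) ∈ ts →
  Below c (λ i j → (i , j) ∈ ts₁) i j ⊎ Shifted c (λ i j → (i , j) ∈ ts₂) i j

Conn-split : ∀ c {ts ts₁ ts₂} → SplitsAt c ts ts₁ ts₂ →
             ∀ {i j} → Conn ts i j → Below c (Conn ts₁) i j ⊎ Shifted c (Conn ts₂) i j
Conn-split c split {i} c-refl with i <? c
... | yes i<c = inj₁ (i<c , i<c , c-refl)
... | no i≮c  = let i-eq = sym (m+[n∸m]≡n (≮⇒≥ i≮c)) in inj₂ (i ∸ c , i ∸ c , i-eq , i-eq , c-refl)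
Conn-split c split (c-edge e) with split e
... | inj₁ (i<c , j<c , e′)          = inj₁ (i<c , j<c , c-edge e′)
... | inj₂ (i′ , j′ , p , q , e′) = inj₂ (i′ , j′ , p , q , c-edge e′)
Conn-split c split (c-sym d) with Conn-split c split d
... | inj₁ (i<c , j<c , d′)          = inj₁ (j<c , i<c , c-sym d′)
... | inj₂ (i′ , j′ , p , q , d′) = inj₂ (j′ , i′ , q , p , c-sym d′)
Conn-split c split (c-trans d₁ d₂) with Conn-split c split d₁ | Conn-split c split d₂
... | inj₁ (i<c , _ , d₁′) | inj₁ (_ , k<c , d₂′) = inj₁ (i<c , k<c , c-trans d₁′ d₂′)
... | inj₂ (i′ , j′ , p , q , d₁′) | inj₂ (j″ , k′ , p′ , q′ , d₂′) =
  inj₂ (i′ , k′ , p , q′ ,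
        c-trans d₁′ (subst (λ z → Conn _ z k′) (+-cancelˡ-≡ c _ _ (trans (sym p′) q)) d₂′))
... | inj₁ (_ , j<c , _) | inj₂ (_ , _ , refl , _ , _) = ⊥-elim (m+n≮m _ _ j<c)
... | inj₂ (_ , _ , _ , refl , _) | inj₁ (j<c , _ , _) = ⊥-elim (m+n≮m _ _ j<c)

padRight : ℕ → List Bool → List Bool
padRight b r = r ++ replicate b false

padLeft : ℕ → List Bool → List Bool
padLeft a r = replicate a false ++ r

blockDiag : ℕ → ℕ → Matrix → Matrix → Matrix
blockDiag a b R₁ R₂ = map (padRight b) R₁ ++ map (padLeft a) R₂

topLeft : ℕ → Matrix → Matrix
topLeft c R = map (take c) (take c R)

bottomRight : ℕ → Matrix → Matrix
bottomRight c R = map (drop c) (drop c R)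

map-map-inverse : ∀ {f : A → B} {g : B → A} {xs} → All (λ x → g (f x) ≡ x) xs → map g (map f xs) ≡ xs
map-map-inverse {xs = xs} p = trans (sym (map-∘ xs)) (map-id-local p)

length-map-padRight : ∀ {a} b {R₁} → Shape a R₁ → length (map (padRight b) R₁) ≡ a
length-map-padRight b {R₁} (len , _) = trans (length-map _ R₁) len

Shape-blockDiag : ∀ {a b R₁ R₂} → Shape a R₁ → Shape b R₂ → Shape (a + b) (blockDiag a b R₁ R₂)
Shape-blockDiag {a} {b} {R₁} {R₂} sh₁@(_ , rows₁) (len₂ , rows₂) =
  trans (length-++ (map (padRight b) R₁)) (cong₂ _+_ (length-map-padRight b sh₁) (trans (length-map _ R₂) len₂)) ,
  All.++⁺ (All.map⁺ (All.map (λ {r} p → trans (length-++ r) (cong₂ _+_ p (length-replicate b))) rows₁))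
          (All.map⁺ (All.map (λ {r} p → trans (length-++ (replicate a false)) (cong₂ _+_ (length-replicate a) p)) rows₂))

SamePart-blockDiag⁺ˡ : ∀ {a b R₁ R₂ i j} → SamePart R₁ i j → SamePart (blockDiag a b R₁ R₂) i j
SamePart-blockDiag⁺ˡ {b = b} (r , A , B) = padRight b r , At-++⁺ˡ (At-map⁺ (padRight b) A) , At-++⁺ˡ B

SamePart-blockDiag⁺ʳ : ∀ {a b R₁ R₂ i j} → Shape a R₁ → SamePart R₂ i j →
                       SamePart (blockDiag a b R₁ R₂) (a + i) (a + j)
SamePart-blockDiag⁺ʳ {a} {b} {R₁} {R₂} {i} {j} sh₁ (r , A , B) =
  padLeft a r ,
  subst (λ z → At (blockDiag a b R₁ R₂) (z + i) (padLeft a r)) (length-map-padRight b sh₁)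
    (At-++⁺ʳ (map (padRight b) R₁) (At-map⁺ (padLeft a) A)) ,
  subst (λ z → At (padLeft a r) (z + j) true) (length-replicate a) (At-++⁺ʳ (replicate a false) B)

SamePart-blockDiag⁻ : ∀ {a b R₁ R₂ i j} → Shape a R₁ → SamePart (blockDiag a b R₁ R₂) i j →
                      Below a (SamePart R₁) i j ⊎ Shifted a (SamePart R₂) i j
SamePart-blockDiag⁻ {a} {b} {R₁} sh₁@(_ , rows₁) (_ , A , B) with At-++⁻ (map (padRight b) R₁) A
... | inj₁ (i< , A₁) with At-map⁻ A₁
...   | r , Ar , refl with At-++⁻ r B
...     | inj₁ (j< , B₁) = inj₁
  (subst (_ <_) (length-map-padRight b sh₁) i< , subst (_ <_) (At-All rows₁ Ar) j< , r , Ar , B₁)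
...     | inj₂ (_ , _ , B₂) = ⊥-elim (¬At-replicate-false b B₂)
SamePart-blockDiag⁻ {a} {b} {R₁} sh₁ (_ , A , B) | inj₂ (i′ , refl , A₂) with At-map⁻ A₂
...   | r , Ar , refl with At-++⁻ (replicate a false) B
...     | inj₁ (_ , B₁) = ⊥-elim (¬At-replicate-false a B₁)
...     | inj₂ (j′ , refl , B₂) =
  inj₂ (i′ , j′ , cong (_+ i′) (length-map-padRight b sh₁) , cong (_+ j′) (length-replicate a) , r , Ar , B₂)

take-padRight : ∀ {a} b {r} → length r ≡ a → take a (padRight b r) ≡ r
take-padRight b {r} refl = take-length-++ r _

drop-padLeft : ∀ a r → drop a (padLeft a r) ≡ r
drop-padLeft a r = subst (λ z → drop z (padLeft a r) ≡ r) (length-replicate a) (drop-length-++ (replicate a false) r)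

take-blockDiag : ∀ {a} b {R₁} R₂ → Shape a R₁ → take a (blockDiag a b R₁ R₂) ≡ map (padRight b) R₁
take-blockDiag {a} b {R₁} R₂ sh₁ =
  subst (λ z → take z (blockDiag a b R₁ R₂) ≡ map (padRight b) R₁) (length-map-padRight b sh₁) (take-length-++ _ _)

drop-blockDiag : ∀ {a} b {R₁} R₂ → Shape a R₁ → drop a (blockDiag a b R₁ R₂) ≡ map (padLeft a) R₂
drop-blockDiag {a} b {R₁} R₂ sh₁ =
  subst (λ z → drop z (blockDiag a b R₁ R₂) ≡ map (padLeft a) R₂) (length-map-padRight b sh₁)
    (drop-length-++ (map (padRight b) R₁) _)

topLeft-blockDiag : ∀ {a b R₁ R₂} → Shape a R₁ → topLeft a (blockDiag a b R₁ R₂) ≡ R₁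
topLeft-blockDiag {a} {b} {R₁} {R₂} sh₁@(_ , rows₁) = begin
  map (take a) (take a (blockDiag a b R₁ R₂))  ≡⟨ cong (map (take a)) (take-blockDiag b R₂ sh₁) ⟩
  map (take a) (map (padRight b) R₁)          ≡⟨ map-map-inverse (All.map (take-padRight b) rows₁) ⟩
  R₁                                          ∎
  where open ≡-Reasoning

bottomRight-blockDiag : ∀ {a b R₁ R₂} → Shape a R₁ → bottomRight a (blockDiag a b R₁ R₂) ≡ R₂
bottomRight-blockDiag {a} {b} {R₁} {R₂} sh₁ = begin
  map (drop a) (drop a (blockDiag a b R₁ R₂))  ≡⟨ cong (map (drop a)) (drop-blockDiag b R₂ sh₁) ⟩
  map (drop a) (map (padLeft a) R₂)           ≡⟨ map-map-inverse (All.tabulate λ {r} _ → drop-padLeft a r) ⟩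
  R₂                                          ∎
  where open ≡-Reasoning

Shape-topLeft : ∀ {n c R} → Shape n R → c ≤ n → Shape c (topLeft c R)
Shape-topLeft {n} {c} {R} (len , rows) c≤n =
  trans (length-map _ (take c R)) (length-take-≤ c R (subst (c ≤_) (sym len) c≤n)) ,
  All-At _ λ A → let row , A₁ , e = At-map⁻ A in
    trans (cong length e) (length-take-≤ c row (subst (c ≤_) (sym (At-All rows (proj₂ (At-take⁻ c A₁)))) c≤n))

Shape-bottomRight : ∀ {n c R} → Shape n R → Shape (n ∸ c) (bottomRight c R)
Shape-bottomRight {n} {c} {R} (len , rows) =
  trans (length-map _ (drop c R)) (trans (length-drop c R) (cong (_∸ c) len)) ,
  All-At _ λ A → let row , A₁ , e = At-map⁻ A in
    trans (cong length e) (trans (length-drop c row) (cong (_∸ c) (At-All rows (At-drop⁻ c A₁))))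

Separated : ℕ → ℕ → Matrix → Set
Separated n c R = ∀ i j → i < c → c ≤ j → j < n → ¬ SamePart R i j × ¬ SamePart R j i

Separated⇒blockDiag : ∀ {n c R} → Shape n R → c ≤ n → Separated n c R →
                      R ≡ blockDiag c (n ∸ c) (topLeft c R) (bottomRight c R)
Separated⇒blockDiag {n} {c} {R} (len , rows) c≤n sep =
  trans (sym (take++drop≡id c R))
    (cong₂ _++_ (sym (map-map-inverse (All-At _ upper))) (sym (map-map-inverse (All-At _ lower))))
  where
  upper : ∀ {i row} → At (take c R) i row → padRight (n ∸ c) (take c row) ≡ row
  upper {i} {row} A with At-take⁻ c A
  ... | i<c , A′ = trans (cong (take c row ++_) (sym right-false)) (take++drop≡id c row)
    where
    row-len = At-All rows A′
    right-false : drop c row ≡ replicate (n ∸ c) false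
    right-false = trans (¬At-true⇒replicate-false (drop c row)
                          λ {j} B → proj₁ (sep i (c + j) i<c (m≤m+n c j)
                            (subst (c + j <_) row-len (At⇒<length (At-drop⁻ c B))))
                                      (row , A′ , At-drop⁻ c B))
                        (cong (λ z → replicate z false) (trans (length-drop c row) (cong (_∸ c) row-len)))
  lower : ∀ {i row} → At (drop c R) i row → padLeft c (drop c row) ≡ row
  lower {i} {row} A = trans (cong (_++ drop c row) (sym left-false)) (take++drop≡id c row)
    where
    A′ = At-drop⁻ c A
    row-len = At-All rows A′
    left-false : take c row ≡ replicate c false
    left-false = trans (¬At-true⇒replicate-false (take c row)
                         λ B → let j<c , B′ = At-take⁻ c B in
                           proj₂ (sep _ (c + i) j<c (m≤m+n c i) (subst (c + i <_) len (At⇒<length A′)))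
                                 (row , A′ , B′))
                       (cong (λ z → replicate z false) (length-take-≤ c row (subst (c ≤_) (sym row-len) c≤n)))

SamePart-topLeft⁺ : ∀ {c R i j} → i < c → j < c → SamePart R i j → SamePart (topLeft c R) i j
SamePart-topLeft⁺ {c} i<c j<c (row , A , B) = take c row , At-map⁺ (take c) (At-take⁺ c i<c A) , At-take⁺ c j<c B

SamePart? : ∀ R i j → Dec (SamePart R i j)
SamePart? R i j with At-lookup R i
... | inj₂ no-row = no λ (row , A , _) → no-row row A
... | inj₁ (row , A) with At-lookup row j
...   | inj₂ no-entry    = no λ (row′ , A′ , B′) →
  no-entry true (subst (λ r → At r j true) (At-functional A′ A) B′)
...   | inj₁ (true , B)  = yes (row , A , B)
...   | inj₁ (false , B) = no λ (row′ , A′ , B′) →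
  case At-functional (subst (λ r → At r j true) (At-functional A′ A) B′) B of λ ()

-- Splitting at a block boundary

record TieSplit (a : ℕ) (ts ts₁ ts₂ : List Tie) : Set where
  field
    sides  : SplitsAt a ts ts₁ ts₂
    left⊆  : ∀ {i j} → (i , j) ∈ ts₁ → Below a (λ i j → (i , j) ∈ ts) i j
    right⊆ : ∀ {t} → t ∈ ts₂ → shiftTie a t ∈ ts

  Conn⁺ˡ : ∀ {i j} → Conn ts₁ i j → Conn ts i j
  Conn⁺ˡ = Conn-mono (proj₂ ∘′ proj₂ ∘′ left⊆)

  Conn⁺ʳ : ∀ {i j} → Conn ts₂ i j → Conn ts (a + i) (a + j)
  Conn⁺ʳ c = Conn-mono (λ m → let _ , m′ , e = ∈-map⁻ (shiftTie a) m in subst (_∈ ts) (sym e) (right⊆ m′))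
                       (Conn-shift a c)

  Conn⁻ˡ : ∀ {i j} → i < a → Conn ts i j → Conn ts₁ i j
  Conn⁻ˡ i<a c with Conn-split a sides c
  ... | inj₁ (_ , _ , c₁)              = c₁
  ... | inj₂ (_ , _ , refl , _ , _) = ⊥-elim (m+n≮m _ _ i<a)

  Conn⁻ʳ : ∀ {i j} → Conn ts (a + i) (a + j) → Conn ts₂ i j
  Conn⁻ʳ c with Conn-split a sides c
  ... | inj₁ (a+i<a , _ , _)             = ⊥-elim (m+n≮m _ _ a+i<a)
  ... | inj₂ (_ , _ , e₁ , e₂ , c₂) =
    subst₂ (Conn ts₂) (sym (+-cancelˡ-≡ a _ _ e₁)) (sym (+-cancelˡ-≡ a _ _ e₂)) c₂

TaPartition-blockDiag⁺ : ∀ {a b ts ts₁ ts₂ R₁ R₂} → TieSplit a ts ts₁ ts₂ →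
                         TaPartition a ts₁ R₁ → TaPartition b ts₂ R₂ →
                         TaPartition (a + b) ts (blockDiag a b R₁ R₂)
TaPartition-blockDiag⁺ {a} {b} {ts} {R₁ = R₁} {R₂} split (sh₁ , part₁) (sh₂ , part₂) =
  Shape-blockDiag sh₁ sh₂ , λ i j i< j< → mk⇔ (same⇒conn i< j<) (conn⇒same i< j<)
  where
  open TieSplit split
  same⇒conn : ∀ {i j} → i < a + b → j < a + b → SamePart (blockDiag a b R₁ R₂) i j → Conn ts i j
  same⇒conn i< j< sp with SamePart-blockDiag⁻ sh₁ sp
  ... | inj₁ (i<a , j<a , sp₁) = Conn⁺ˡ (to (part₁ _ _ i<a j<a) sp₁)
  ... | inj₂ (_ , _ , refl , refl , sp₂) = Conn⁺ʳ (to (part₂ _ _ (+-cancelˡ-< a _ _ i<) (+-cancelˡ-< a _ _ j<)) sp₂)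
  conn⇒same : ∀ {i j} → i < a + b → j < a + b → Conn ts i j → SamePart (blockDiag a b R₁ R₂) i j
  conn⇒same i< j< c with Conn-split a sides c
  ... | inj₁ (i<a , j<a , c₁) = SamePart-blockDiag⁺ˡ (from (part₁ _ _ i<a j<a) c₁)
  ... | inj₂ (_ , _ , refl , refl , c₂) =
    SamePart-blockDiag⁺ʳ sh₁ (from (part₂ _ _ (+-cancelˡ-< a _ _ i<) (+-cancelˡ-< a _ _ j<)) c₂)

TaPartition-blockDiag⁻ : ∀ {a b ts ts₁ ts₂ R₁ R₂} → TieSplit a ts ts₁ ts₂ → Shape a R₁ → Shape b R₂ →
                         TaPartition (a + b) ts (blockDiag a b R₁ R₂) → TaPartition a ts₁ R₁ × TaPartition b ts₂ R₂
TaPartition-blockDiag⁻ {a} {b} {ts} {ts₁} {ts₂} {R₁} {R₂} split sh₁ sh₂ (_ , part) =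
  (sh₁ , λ i j i<a j<a → mk⇔ (left⇒ i<a j<a) (left⇐ i<a j<a)) ,
  (sh₂ , λ i j i<b j<b → mk⇔ (right⇒ i<b j<b) (right⇐ i<b j<b))
  where
  open TieSplit split
  lift : ∀ {i} → i < a → i < a + b
  lift i<a = <-≤-trans i<a (m≤m+n a b)
  left⇒ : ∀ {i j} → i < a → j < a → SamePart R₁ i j → Conn ts₁ i j
  left⇒ i<a j<a sp = Conn⁻ˡ i<a (to (part _ _ (lift i<a) (lift j<a)) (SamePart-blockDiag⁺ˡ sp))
  left⇐ : ∀ {i j} → i < a → j < a → Conn ts₁ i j → SamePart R₁ i j
  left⇐ i<a j<a c with SamePart-blockDiag⁻ sh₁ (from (part _ _ (lift i<a) (lift j<a)) (Conn⁺ˡ c))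
  ... | inj₁ (_ , _ , sp)             = sp
  ... | inj₂ (_ , _ , refl , _ , _) = ⊥-elim (m+n≮m _ _ i<a)
  right⇒ : ∀ {i j} → i < b → j < b → SamePart R₂ i j → Conn ts₂ i j
  right⇒ i<b j<b sp = Conn⁻ʳ (to (part _ _ (+-monoʳ-< a i<b) (+-monoʳ-< a j<b)) (SamePart-blockDiag⁺ʳ sh₁ sp))
  right⇐ : ∀ {i j} → i < b → j < b → Conn ts₂ i j → SamePart R₂ i j
  right⇐ i<b j<b c with SamePart-blockDiag⁻ sh₁ (from (part _ _ (+-monoʳ-< a i<b) (+-monoʳ-< a j<b)) (Conn⁺ʳ c))
  ... | inj₁ (a+i<a , _ , _)          = ⊥-elim (m+n≮m _ _ a+i<a)
  ... | inj₂ (_ , _ , e₁ , e₂ , sp) =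
    subst₂ (SamePart R₂) (sym (+-cancelˡ-≡ a _ _ e₁)) (sym (+-cancelˡ-≡ a _ _ e₂)) sp

TieSplit-¬Conn-across : ∀ {a ts ts₁ ts₂ i j} → TieSplit a ts ts₁ ts₂ → i < a → a ≤ j → ¬ Conn ts i j
TieSplit-¬Conn-across split i<a a≤j c with Conn-split _ (TieSplit.sides split) c
... | inj₁ (_ , j<a , _)           = <⇒≱ j<a a≤j
... | inj₂ (_ , _ , refl , _ , _) = m+n≮m _ _ i<a

TaPartition⇒Separated : ∀ {a n ts ts₁ ts₂ R} → TieSplit a ts ts₁ ts₂ → TaPartition n ts R → a ≤ n →
                        Separated n a R
TaPartition⇒Separated split (_ , part) a≤n i j i<a a≤j j<n =
  (λ sp → ¬across (to (part i j i<n j<n) sp)) , (λ sp → ¬across (c-sym (to (part j i j<n i<n) sp)))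
  where
  i<n = <-≤-trans i<a a≤n
  ¬across = TieSplit-¬Conn-across split i<a a≤j

juxtaposeTies : ℕ → List Tie → List Tie → List Tie
juxtaposeTies a ts₁ ts₂ = ts₁ ++ map (shiftTie a) ts₂

TieSplit-juxtaposeTies : ∀ {a ts₁ ts₂} → (∀ {i j} → (i , j) ∈ ts₁ → i < a × j < a) →
                         TieSplit a (juxtaposeTies a ts₁ ts₂) ts₁ ts₂
TieSplit-juxtaposeTies {a} {ts₁} {ts₂} below = record
  { sides  = sides
  ; left⊆  = λ m → let i<a , j<a = below m in i<a , j<a , ∈-++⁺ˡ m
  ; right⊆ = λ m → ∈-++⁺ʳ ts₁ (∈-map⁺ (shiftTie a) m)
  }
  where
  sides : SplitsAt a (juxtaposeTies a ts₁ ts₂) ts₁ ts₂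
  sides m with ∈-++⁻ ts₁ m
  ... | inj₁ m₁ = let i<a , j<a = below m₁ in inj₁ (i<a , j<a , m₁)
  ... | inj₂ m₂ with ∈-map⁻ (shiftTie a) m₂
  ...   | _ , m₂′ , refl = inj₂ (_ , _ , refl , refl , m₂′)

unshiftTie : ℕ → Tie → Tie
unshiftTie a (i , j) = i ∸ a , j ∸ a

below? : ∀ a (t : Tie) → Dec (proj₁ t < a × proj₂ t < a)
below? a (i , j) = (i <? a) ×-dec (j <? a)

above? : ∀ a (t : Tie) → Dec (a ≤ proj₁ t × a ≤ proj₂ t)
above? a (i , j) = (a ≤? i) ×-dec (a ≤? j)

tiesBelow : ℕ → List Tie → List Tie
tiesBelow a = filter (below? a)

tiesAbove : ℕ → List Tie → List Tie
tiesAbove a ts = map (unshiftTie a) (filter (above? a) ts)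

TieSplit-filter : ∀ {a ts} → (∀ {i j} → (i , j) ∈ ts → SameSide a i j) →
                  TieSplit a ts (tiesBelow a ts) (tiesAbove a ts)
TieSplit-filter {a} {ts} sameSide = record
  { sides  = sides
  ; left⊆  = λ m → let m′ , i<a , j<a = ∈-filter⁻ (below? a) m in i<a , j<a , m′
  ; right⊆ = right⊆
  }
  where
  sides : SplitsAt a ts (tiesBelow a ts) (tiesAbove a ts)
  sides m with sameSide m
  ... | inj₁ (i<a , j<a) = inj₁ (i<a , j<a , ∈-filter⁺ (below? a) m (i<a , j<a))
  ... | inj₂ (a≤i , a≤j) = inj₂ (_ , _ , sym (m+[n∸m]≡n a≤i) , sym (m+[n∸m]≡n a≤j) ,
                                 ∈-map⁺ (unshiftTie a) (∈-filter⁺ (above? a) m (a≤i , a≤j)))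
  right⊆ : ∀ {t} → t ∈ tiesAbove a ts → shiftTie a t ∈ ts
  right⊆ m with ∈-map⁻ (unshiftTie a) m
  ... | _ , m₀ , refl with ∈-filter⁻ (above? a) m₀
  ...   | m₀′ , a≤i , a≤j = subst (_∈ ts) (sym (cong₂ _,_ (m+[n∸m]≡n a≤i) (m+[n∸m]≡n a≤j))) m₀′

¬Cross-separated : ∀ {w a i j k l} → i < a → j < a → a ≤ k → a ≤ l →
                   ¬ Cross w (i , j) (k , l) × ¬ Cross w (k , l) (i , j)
¬Cross-separated i<a j<a a≤k a≤l =
  let ¬left , ¬right = ¬Interleave-separated i<a j<a a≤k a≤l in
  (λ (_ , _ , _ , I) → ¬left I) , (λ (_ , _ , _ , I) → ¬right I)

BlockBoundary : ℕ → List Bool → Matrix → ℕ → Set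
BlockBoundary n w R c = ∀ i j → i < c → c ≤ j → j < n → Top w i → Top w j → ¬ SamePart R i j

module TieTransfer {u v : List Bool} (bu : Balanced u) where
  open Concatenation u v

  All-ValidTie-juxtapose : ∀ {b ts₁ ts₂} → All (ValidTie u (numClose u)) ts₁ → All (ValidTie v b) ts₂ →
                           All (ValidTie (u ++ v) (numClose u + b)) (juxtaposeTies (numClose u) ts₁ ts₂)
  All-ValidTie-juxtapose V₁ V₂ = All.++⁺ (All.map (ValidTie-++⁺ˡ bu (m≤m+n _ _)) V₁)
    (All.map⁺ (All.map (ValidTie-++⁺ʳ bu) V₂))

  NonCrossing-juxtapose : ∀ {ts₁ ts₂} → All (ValidTie u (numClose u)) ts₁ →
                          NonCrossing u ts₁ → NonCrossing v ts₂ →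
                          NonCrossing (u ++ v) (juxtaposeTies (numClose u) ts₁ ts₂)
  NonCrossing-juxtapose {ts₁} V₁ NC₁ NC₂ {i , j} {k , l} m m′ with ∈-++⁻ ts₁ m | ∈-++⁻ ts₁ m′
  ... | inj₁ m₁ | inj₁ m₁′ = let i< , j< , _ = All.lookup V₁ m₁ ; k< , l< , _ = All.lookup V₁ m₁′ in
                             NC₁ m₁ m₁′ ∘′ Cross-++⁻ˡ bu i< j< k< l<
  ... | inj₂ m₂ | inj₂ m₂′ with ∈-map⁻ _ m₂ | ∈-map⁻ _ m₂′
  ...   | _ , n₂ , refl | _ , n₂′ , refl = NC₂ n₂ n₂′ ∘′ Cross-++⁻ʳ bu
  NonCrossing-juxtapose {ts₁} V₁ NC₁ NC₂ {i , j} {k , l} m m′ | inj₁ m₁ | inj₂ m₂′ with ∈-map⁻ _ m₂′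
  ... | _ , _ , refl = let i< , j< , _ = All.lookup V₁ m₁ in proj₁ (¬Cross-separated i< j< (m≤m+n _ _) (m≤m+n _ _))
  NonCrossing-juxtapose {ts₁} V₁ NC₁ NC₂ {i , j} {k , l} m m′ | inj₂ m₂ | inj₁ m₁′ with ∈-map⁻ _ m₂
  ... | _ , _ , refl = let k< , l< , _ = All.lookup V₁ m₁′ in proj₂ (¬Cross-separated k< l< (m≤m+n _ _) (m≤m+n _ _))

  All-ValidTie-split : ∀ {b ts ts₁ ts₂} → TieSplit (numClose u) ts ts₁ ts₂ →
                       All (ValidTie (u ++ v) (numClose u + b)) ts →
                       All (ValidTie u (numClose u)) ts₁ × All (ValidTie v b) ts₂
  All-ValidTie-split split V =
    All.tabulate (λ m → let i< , j< , m′ = left⊆ m in ValidTie-++⁻ˡ bu i< j< (All.lookup V m′)) ,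
    All.tabulate (λ m → ValidTie-++⁻ʳ bu (All.lookup V (right⊆ m)))
    where open TieSplit split

  NonCrossing-split : ∀ {ts ts₁ ts₂} → TieSplit (numClose u) ts ts₁ ts₂ → NonCrossing (u ++ v) ts →
                      NonCrossing u ts₁ × NonCrossing v ts₂
  NonCrossing-split split NC =
    (λ m m′ → let i< , j< , n = left⊆ m ; k< , l< , n′ = left⊆ m′ in NC n n′ ∘′ Cross-++⁺ˡ bu i< j< k< l<) ,
    (λ m m′ → NC (right⊆ m) (right⊆ m′) ∘′ Cross-++⁺ʳ bu)
    where open TieSplit split

  SameSide-boundary : ∀ {n ts R} → All (ValidTie (u ++ v) n) ts → TaPartition n ts R →
                      BlockBoundary n (u ++ v) R (numClose u) → ∀ {i j} → (i , j) ∈ ts → SameSide (numClose u) i j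
  SameSide-boundary V (_ , part) boundary {i} {j} m with All.lookup V m
  ... | i<n , j<n , _ , nothing , inj₁ (top-i , top-j) with i <? numClose u | j <? numClose u
  ...   | yes i<u | yes j<u = inj₁ (i<u , j<u)
  ...   | no i≮u  | no j≮u  = inj₂ (≮⇒≥ i≮u , ≮⇒≥ j≮u)
  ...   | yes i<u | no j≮u  = ⊥-elim (boundary i j i<u (≮⇒≥ j≮u) j<n top-i top-j (from (part i j i<n j<n) (c-edge m)))
  ...   | no i≮u  | yes j<u = ⊥-elim
    (boundary j i j<u (≮⇒≥ i≮u) i<n top-j top-i (from (part j i j<n i<n) (c-sym (c-edge m))))
  SameSide-boundary V _ _ m | _ , _ , _ , just p , inj₁ (Pi , Pj) =
    SameSide-trans (Inside-++-side bu (proj₁ Pi)) (SameSide-sym (Inside-++-side bu (proj₁ Pj)))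
  SameSide-boundary V _ _ m | _ , _ , _ , _ , inj₂ (inj₁ (P , _)) = Inside-++-side bu (proj₁ P)
  SameSide-boundary V _ _ m | _ , _ , _ , _ , inj₂ (inj₂ (P , _)) = SameSide-sym (Inside-++-side bu (proj₁ P))

Diagram : Set
Diagram = List Bool × Matrix

juxtapose : ℕ → ℕ → Diagram → Diagram → Diagram
juxtapose a b (w₁ , R₁) (w₂ , R₂) = w₁ ++ w₂ , blockDiag a b R₁ R₂

IsArcDiagram⇒Balanced : ∀ {n w} → IsArcDiagram n w → Balanced w
IsArcDiagram⇒Balanced {w = w} (_ , d) = balanced (dyck⇒height 0 w d)

IsArcDiagram⇒numClose : ∀ {n w} → IsArcDiagram n w → numClose w ≡ n
IsArcDiagram⇒numClose {n} {w} ad@(len , _) = Balanced-numClose {w} (IsArcDiagram⇒Balanced {n} ad) len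

Balanced⇒IsArcDiagram : ∀ {n w} → Balanced w → numClose w ≡ n → IsArcDiagram n w
Balanced⇒IsArcDiagram {w = w} bw refl = Balanced-length bw , height⇒dyck 0 w (returns bw)

TaClass-juxtapose : ∀ {a b y₁ y₂} → TaClass a y₁ → TaClass b y₂ → TaClass (a + b) (juxtapose a b y₁ y₂)
TaClass-juxtapose {a} {b} {w₁ , R₁} {w₂ , R₂} t₁@(ad₁ , _) t₂ with IsArcDiagram⇒numClose {a} {w₁} ad₁
... | refl = juxtapose′ t₁ t₂
  where
  juxtapose′ : TaClass (numClose w₁) (w₁ , R₁) → TaClass b (w₂ , R₂) →
               TaClass (numClose w₁ + b) (w₁ ++ w₂ , blockDiag (numClose w₁) b R₁ R₂)
  juxtapose′ (ad₁ , ts₁ , V₁ , NC₁ , part₁) (ad₂ , ts₂ , V₂ , NC₂ , part₂) =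
    Balanced⇒IsArcDiagram (Balanced-++ b₁ (IsArcDiagram⇒Balanced {b} ad₂))
                          (trans (numClose-++ w₁ w₂) (cong (numClose w₁ +_) (IsArcDiagram⇒numClose {b} {w₂} ad₂))) ,
    juxtaposeTies (numClose w₁) ts₁ ts₂ ,
    All-ValidTie-juxtapose V₁ V₂ ,
    NonCrossing-juxtapose V₁ NC₁ NC₂ ,
    TaPartition-blockDiag⁺ (TieSplit-juxtaposeTies (λ m → let i< , j< , _ = All.lookup V₁ m in i< , j<)) part₁ part₂
    where
    b₁ = IsArcDiagram⇒Balanced {numClose w₁} ad₁
    open TieTransfer b₁

TaClass-split : ∀ {n u v R} → Balanced u → Balanced v → TaClass n (u ++ v , R) →
  BlockBoundary n (u ++ v) R (numClose u) →
  let a = numClose u in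
  TaClass a (u , topLeft a R) × TaClass (n ∸ a) (v , bottomRight a R) ×
  R ≡ blockDiag a (n ∸ a) (topLeft a R) (bottomRight a R)
TaClass-split {n} {u} {v} {R} bu bv (ad , ts , V , NC , part@(shape , _)) boundary =
  (Balanced⇒IsArcDiagram bu refl , tiesBelow a ts , V₁ , NC₁ , part₁) ,
  (Balanced⇒IsArcDiagram bv v-arcs , tiesAbove a ts , V₂ , NC₂ , part₂) ,
  R-blocks
  where
  open TieTransfer bu
  a = numClose u
  n-split : n ≡ a + numClose v
  n-split = trans (sym (IsArcDiagram⇒numClose {n} {u ++ v} ad)) (numClose-++ u v)
  a≤n : a ≤ n
  a≤n = subst (a ≤_) (sym n-split) (m≤m+n a _)
  a+b≡n : a + (n ∸ a) ≡ n
  a+b≡n = m+[n∸m]≡n a≤n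
  v-arcs : numClose v ≡ n ∸ a
  v-arcs = sym (trans (cong (_∸ a) n-split) (m+n∸m≡n a _))
  split = TieSplit-filter (SameSide-boundary V part boundary)
  R-blocks : R ≡ blockDiag a (n ∸ a) (topLeft a R) (bottomRight a R)
  R-blocks = Separated⇒blockDiag shape a≤n (TaPartition⇒Separated split part a≤n)
  V₁ = proj₁ (All-ValidTie-split split (subst (λ m → All (ValidTie (u ++ v) m) ts) (sym a+b≡n) V))
  V₂ = proj₂ (All-ValidTie-split split (subst (λ m → All (ValidTie (u ++ v) m) ts) (sym a+b≡n) V))
  NC₁ = proj₁ (NonCrossing-split split NC)
  NC₂ = proj₂ (NonCrossing-split split NC)
  parts = TaPartition-blockDiag⁻ split (Shape-topLeft shape a≤n) (Shape-bottomRight {c = a} shape)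
            (subst₂ (λ m R′ → TaPartition m ts R′) (sym a+b≡n) R-blocks part)
  part₁ = proj₁ parts
  part₂ = proj₂ parts

-- The first block

least? : ∀ (P : ℕ → Set) m → (∀ i → i < m → Dec (P i)) →
         (∃ λ i → i < m × P i × (∀ j → j < i → ¬ P j)) ⊎ (∀ i → i < m → ¬ P i)
least? P zero    P? = inj₂ (λ _ ())
least? P (suc m) P? with least? P m (λ i i<m → P? i (m<n⇒m<1+n i<m))
... | inj₁ (i , i<m , p , below) = inj₁ (i , m<n⇒m<1+n i<m , p , below)
... | inj₂ none with P? m ≤-refl
...   | yes p = inj₁ (m , ≤-refl , p , none)
...   | no ¬p = inj₂ λ i i<1+m → [ none i , (λ { refl → ¬p }) ]′ (m≤n⇒m<n∨m≡n (s≤s⁻¹ i<1+m))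

PartAcross : ℕ → List Bool → Matrix → ℕ → Set
PartAcross n w R c = ∃₂ λ i j → i < c × c ≤ j × j < n × Top w i × Top w j × SamePart R i j

PartAcross⊎BlockBoundary : ∀ {n w R c} → Balanced w → numClose w ≡ n → c ≤ n →
                           PartAcross n w R c ⊎ BlockBoundary n w R c
PartAcross⊎BlockBoundary {n} {w} {R} {c} bw refl c≤n with least? Partner c partner?
  where
  Partner : ℕ → Set
  Partner i = Top w i × ∃ λ j → j < n × c ≤ j × Top w j × SamePart R i j
  partner? : ∀ i → i < c → Dec (Partner i)
  partner? i i<c with Top? bw (<-≤-trans i<c c≤n)
                    | least? (λ j → c ≤ j × Top w j × SamePart R i j) n
                             (λ j j<n → (c ≤? j) ×-dec (Top? bw j<n ×-dec SamePart? R i j))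
  ... | no ¬top | _ = no (¬top ∘′ proj₁)
  ... | yes top | inj₁ (j , j<n , p , _) = yes (top , j , j<n , p)
  ... | yes top | inj₂ none = no λ (_ , j , j<n , p) → none j j<n p
... | inj₁ (i , i<c , (top-i , j , j<n , c≤j , top-j , same) , _) = inj₁ (i , j , i<c , c≤j , j<n , top-i , top-j , same)
... | inj₂ none = inj₂ λ i j i<c c≤j j<n top-i top-j same → none i i<c (top-i , j , j<n , c≤j , top-j , same)

-- The first c arcs of w form a union of blocks.
BlockPrefix : ℕ → List Bool → Matrix → ℕ → Set
BlockPrefix n w R c = 0 < c × Balanced (take (2 * c) w) × BlockBoundary n w R c

BlockPrefix? : ∀ {n w R c} → Balanced w → numClose w ≡ n → c ≤ n → Dec (BlockPrefix n w R c)
BlockPrefix? {n} {w} {R} {c} bw w-arcs c≤n = (0 <? c) ×-dec (Balanced? (take (2 * c) w) ×-dec boundary?)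
  where
  boundary? : Dec (BlockBoundary n w R c)
  boundary? with PartAcross⊎BlockBoundary bw w-arcs c≤n
  ... | inj₁ (i , j , i<c , c≤j , j<n , top-i , top-j , same) = no λ boundary → boundary i j i<c c≤j j<n top-i top-j same
  ... | inj₂ boundary = yes boundary

-- For consecutive top arcs p < q of u, the prefix ending with the top arc p is balanced, so by
-- minimality some part joins a top arc at or before p to a top arc at or after q.
OneBlock-first : ∀ {n u v R} → Balanced u → Balanced (u ++ v) → numClose (u ++ v) ≡ n → 0 < numClose u →
  BlockBoundary n (u ++ v) R (numClose u) →
  (∀ c → 0 < c → c < numClose u → Balanced (take (2 * c) (u ++ v)) → PartAcross n (u ++ v) R c) →
  OneBlock (numClose u) u (topLeft (numClose u) R)
OneBlock-first {n} {u} {v} {R} bu buv refl 0<a boundary minimal =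
  (pred a , pred< 0<a , Top-++⁻ˡ (Top-++-last bu refl 0<a)) , consecutive
  where
  open Concatenation u v
  a = numClose u
  a≤n : a ≤ numClose (u ++ v)
  a≤n = subst (a ≤_) (sym (numClose-++ u v)) (m≤m+n a _)
  consecutive : ∀ p q → p < q → q < a → Top u p → Top u q → (∀ k → p < k → k < q → ¬ Top u k) →
                ∃₂ λ i j → i ≤ p × q ≤ j × j < a × Top u i × Top u j × SamePart (topLeft a R) i j
  consecutive p q p<q q<a top-p top-q no-top-between with minimal (suc p) z<s (≤-<-trans p<q q<a) prefix
    where
    p<a = <-trans p<q q<a
    prefix = Balanced⇒TopPrefix buv (<-≤-trans p<a a≤n) (Top-++⁺ˡ bu p<a top-p)
  ... | i , j , i≤p , p<j , j<n , top-i , top-j , same =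
    i , j , s≤s⁻¹ i≤p , q≤j , j<a , Top-++⁻ˡ top-i , Top-++⁻ˡ top-j ,
    SamePart-topLeft⁺ (<-trans i≤p (≤-<-trans p<q q<a)) j<a same
    where
    j<a : j < a
    j<a with j <? a
    ... | yes j<a = j<a
    ... | no j≮a  = ⊥-elim (boundary i j (<-trans i≤p (≤-<-trans p<q q<a)) (≮⇒≥ j≮a) j<n top-i top-j same)
    q≤j : q ≤ j
    q≤j with q ≤? j
    ... | yes q≤j = q≤j
    ... | no q≰j  = ⊥-elim (no-top-between j p<j (≰⇒> q≰j) (Top-++⁻ˡ top-j))

FirstBlockDecomposition : ℕ → ℕ → Diagram → Set
FirstBlockDecomposition n c y =
  ∃₂ λ y₁ y₂ → TaClass1 c y₁ × TaClass (n ∸ c) y₂ × y ≡ juxtapose c (n ∸ c) y₁ y₂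

first-block-split : ∀ {n u v R} → Balanced u → Balanced v → 0 < numClose u → TaClass n (u ++ v , R) →
  BlockBoundary n (u ++ v) R (numClose u) →
  (∀ c → 0 < c → c < numClose u → Balanced (take (2 * c) (u ++ v)) → PartAcross n (u ++ v) R c) →
  FirstBlockDecomposition n (numClose u) (u ++ v , R)
first-block-split {n} {u} {v} {R} bu bv 0<a tc@(ad , _) boundary minimal =
  _ , _ , (T₁ , OneBlock-first bu (Balanced-++ bu bv) (IsArcDiagram⇒numClose {n} {u ++ v} ad) 0<a boundary minimal) ,
  T₂ , cong (u ++ v ,_) R-blocks
  where
  pieces = TaClass-split bu bv tc boundary
  T₁ = proj₁ pieces
  T₂ = proj₁ (proj₂ pieces)
  R-blocks = proj₂ (proj₂ pieces)

first-block : ∀ {n w R} → 0 < n → TaClass n (w , R) → ∃ λ c → 0 < c × c ≤ n × FirstBlockDecomposition n c (w , R)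
first-block {n} {w} {R} 0<n tc@(ad , _) = from-least
  (least? (BlockPrefix n w R) (suc n) (λ c c≤n → BlockPrefix? bw w-arcs (s≤s⁻¹ c≤n)))
  where
  bw = IsArcDiagram⇒Balanced {n} ad
  w-arcs = IsArcDiagram⇒numClose {n} {w} ad
  whole : BlockPrefix n w R n
  whole = 0<n , subst Balanced (sym (take-all _ w (≤-reflexive (trans (Balanced-length bw) (cong (2 *_) w-arcs))))) bw ,
          λ _ _ _ n≤j j<n _ _ _ → <⇒≱ j<n n≤j
  from-least : (∃ λ c → c < suc n × BlockPrefix n w R c × (∀ c′ → c′ < c → ¬ BlockPrefix n w R c′)) ⊎
               (∀ c → c < suc n → ¬ BlockPrefix n w R c) →
               ∃ λ c → 0 < c × c ≤ n × FirstBlockDecomposition n c (w , R)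
  from-least (inj₂ none) = ⊥-elim (none n ≤-refl whole)
  from-least (inj₁ (c , c<1+n , (0<c , bu , boundary) , minimal)) =
    c , 0<c , c≤n , subst (λ w′ → FirstBlockDecomposition n c (w′ , R)) w-split
      (subst (λ c′ → FirstBlockDecomposition n c′ (u ++ v , R)) u-arcs
        (first-block-split bu bv (subst (0 <_) (sym u-arcs) 0<c) (subst (λ w′ → TaClass n (w′ , R)) (sym w-split) tc)
          (subst₂ (λ w′ c′ → BlockBoundary n w′ R c′) (sym w-split) (sym u-arcs) boundary) minimal′))
    where
    c≤n = s≤s⁻¹ c<1+n
    u = take (2 * c) w
    v = drop (2 * c) w
    w-split : u ++ v ≡ w
    w-split = take++drop≡id (2 * c) w
    bv = Balanced-++⁻ʳ bu (subst Balanced (sym w-split) bw)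
    u-arcs : numClose u ≡ c
    u-arcs = Balanced-numClose bu
      (length-take-≤ _ w (subst (2 * c ≤_) (sym (trans (Balanced-length bw) (cong (2 *_) w-arcs))) (*-monoʳ-≤ 2 c≤n)))
    minimal′ : ∀ c′ → 0 < c′ → c′ < numClose u → Balanced (take (2 * c′) (u ++ v)) →
               PartAcross n (u ++ v) R c′
    minimal′ c′ 0<c′ c′<u prefix
      with PartAcross⊎BlockBoundary bw w-arcs (<⇒≤ (<-≤-trans (subst (c′ <_) u-arcs c′<u) c≤n))
    ... | inj₁ across   = subst (λ w′ → PartAcross n w′ R c′) (sym w-split) across
    ... | inj₂ boundary′ = ⊥-elim (minimal c′ (subst (c′ <_) u-arcs c′<u)
                                    (0<c′ , subst (λ w′ → Balanced (take (2 * c′) w′)) w-split prefix , boundary′))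

-- Uniqueness of the decomposition

OneBlock⇒PartAcross : ∀ {c u v R} → Balanced (u ++ v) → numClose (u ++ v) ≡ c → OneBlock c (u ++ v) R →
  Balanced u → 0 < numClose u → numClose u < c →
  ∃₂ λ i j → i < numClose u × numClose u ≤ j × j < c × SamePart R i j
OneBlock⇒PartAcross {c} {u} {v} {R} bw w-arcs (_ , consecutive) bu 0<a a<c
  with least? (λ q → numClose u ≤ q × Top (u ++ v) q) c
              (λ q q<c → (numClose u ≤? q) ×-dec Top? bw (subst (q <_) (sym w-arcs) q<c))
... | inj₂ none = ⊥-elim (none (pred c) (pred< 0<c) (<⇒≤pred a<c , Top-last bw w-arcs 0<c))
  where
  0<c = <-trans 0<a a<c
... | inj₁ (q , q<c , (a≤q , top-q) , first-after)
  with consecutive (pred (numClose u)) q (<-≤-trans (pred< 0<a) a≤q) q<c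
                   (Concatenation.Top-++-last u v bu refl 0<a) top-q
                   (λ k pred-a<k k<q top-k → first-after k k<q (pred<⇒≤ 0<a pred-a<k , top-k))
... | i , j , i≤pred-a , q≤j , j<c , _ , _ , same =
  i , j , ≤-<-trans i≤pred-a (pred< 0<a) , ≤-trans a≤q q≤j , j<c , same

juxtapose-OneBlock-maximal : ∀ {c₁ b₁ c₂ b₂ y₁ y₂ y₁′ y₂′} → TaClass1 c₁ y₁ → TaClass c₂ y₁′ →
                             0 < c₂ → c₂ < c₁ → juxtapose c₁ b₁ y₁ y₂ ≢ juxtapose c₂ b₂ y₁′ y₂′
juxtapose-OneBlock-maximal {c₁} {b₁} {c₂} {b₂} {w₁ , R₁} {w₂ , R₂} {w₁′ , R₁′} {w₂′ , R₂′}
                           ((ad₁ , _) , one-block) (ad₁′ , _ , _ , _ , (shape₁′ , _)) 0<c₂ c₂<c₁ eq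
  with OneBlock⇒PartAcross {u = w₁′} {rest}
         (subst Balanced w₁-split (IsArcDiagram⇒Balanced {c₁} ad₁))
         (trans (cong numClose (sym w₁-split)) (IsArcDiagram⇒numClose {c₁} {w₁} ad₁))
         (subst (λ w → OneBlock c₁ w R₁) w₁-split one-block)
         (IsArcDiagram⇒Balanced {c₂} ad₁′) (subst (0 <_) (sym c₂-arcs) 0<c₂) (subst (_< c₁) (sym c₂-arcs) c₂<c₁)
  where
  c₂-arcs = IsArcDiagram⇒numClose {c₂} {w₁′} ad₁′
  rest = drop (length w₁′) w₁
  shorter : length w₁′ ≤ length w₁
  shorter = subst₂ _≤_ (sym (proj₁ ad₁′)) (sym (proj₁ ad₁)) (*-monoʳ-≤ 2 (<⇒≤ c₂<c₁))
  w₁-split : w₁ ≡ w₁′ ++ rest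
  w₁-split = trans (sym (take++drop≡id (length w₁′) w₁))
                   (cong (_++ rest) (trans (sym (take-++ˡ _ w₁ w₂ shorter))
                                           (trans (cong (take (length w₁′) ∘′ proj₁) eq) (take-length-++ w₁′ w₂′))))
... | i , j , i< , ≤j , _ , same
  with SamePart-blockDiag⁻ shape₁′ (subst (λ y → SamePart (proj₂ y) i j) eq (SamePart-blockDiag⁺ˡ same))
...   | inj₁ (_ , j<c₂ , _)         = <⇒≱ j<c₂ (subst (_≤ j) (IsArcDiagram⇒numClose {c₂} {w₁′} ad₁′) ≤j)
...   | inj₂ (_ , _ , refl , _ , _) = m+n≮m _ _ (subst (_ <_) (IsArcDiagram⇒numClose {c₂} {w₁′} ad₁′) i<)

juxtapose-injective : ∀ {a b y₁ y₂ y₁′ y₂′} → TaClass a y₁ → TaClass a y₁′ →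
                      juxtapose a b y₁ y₂ ≡ juxtapose a b y₁′ y₂′ → y₁ ≡ y₁′ × y₂ ≡ y₂′
juxtapose-injective {a} {b} {w₁ , R₁} {w₂ , R₂} {w₁′ , R₁′} {w₂′ , R₂′}
                    ((len₁ , _) , _ , _ , _ , (shape₁ , _)) ((len₁′ , _) , _ , _ , _ , (shape₁′ , _)) eq =
  cong₂ _,_ (proj₁ words)
    (trans (sym (topLeft-blockDiag shape₁)) (trans (cong (topLeft a ∘′ proj₂) eq) (topLeft-blockDiag shape₁′))) ,
  cong₂ _,_ (proj₂ words)
    (trans (sym (bottomRight-blockDiag shape₁)) (trans (cong (bottomRight a ∘′ proj₂) eq) (bottomRight-blockDiag shape₁′)))
  where
  words = ++-injective (trans len₁ (sym len₁′)) (cong proj₁ eq)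

-- Counting

Card-unique : ∀ {X : Set} {P : X → Set} {N M} → Card P N → Card P M → N ≡ M
Card-unique (L , refl , unique-L , ∈L⇔P) (K , refl , unique-K , ∈K⇔P) =
  ↭-length (∼bag⇒↭ (unique∧set⇒bag unique-L unique-K
    (λ {x} → mk⇔ (from (∈K⇔P x) ∘′ to (∈L⇔P x)) (from (∈L⇔P x) ∘′ to (∈K⇔P x)))))

length-concat : ∀ (xss : List (List A)) → length (concat xss) ≡ sum (map length xss)
length-concat []         = refl
length-concat (xs ∷ xss) = trans (length-++ xs) (cong (length xs +_) (length-concat xss))

length-cartesianProduct : ∀ (xs : List A) (ys : List B) → length (cartesianProduct xs ys) ≡ length xs * length ys
length-cartesianProduct []       ys = refl
length-cartesianProduct (x ∷ xs) ys =
  trans (length-++ (map (x ,_) ys)) (cong₂ _+_ (length-map _ ys) (length-cartesianProduct xs ys))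

Unique-map-injectiveOn : ∀ {f : A → B} {xs} → Unique xs → (∀ {x y} → x ∈ xs → y ∈ xs → f x ≡ f y → x ≡ y) →
                         Unique (map f xs)
Unique-map-injectiveOn {xs = []}     []             _   = []
Unique-map-injectiveOn {xs = x ∷ xs} (x∉xs ∷ unique) inj =
  All.map⁺ (All.tabulate λ m fx≡fy → All.lookup x∉xs m (inj (here refl) (there m) fx≡fy)) ∷
  Unique-map-injectiveOn unique (λ m m′ → inj (there m) (there m′))

module Counting {A B : ℕ → ℕ} (card-A : ∀ m → Card (TaClass m) (A m)) (card-B : ∀ m → Card (TaClass1 m) (B m))
                (n : ℕ) where

  classes oneBlockClasses : ℕ → List Diagram
  classes m         = proj₁ (card-A m)
  oneBlockClasses m = proj₁ (card-B m)

  -- (k , y₁ , y₂) stands for y₁ with n ∸ k arcs in one block followed by y₂ with k arcs.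
  Decomposition : Set
  Decomposition = ℕ × Diagram × Diagram

  decompositionsOfSize : ℕ → List Decomposition
  decompositionsOfSize k = map (k ,_) (cartesianProduct (oneBlockClasses (n ∸ k)) (classes k))

  decompositions : List Decomposition
  decompositions = concat (map decompositionsOfSize (upTo n))

  assemble : Decomposition → Diagram
  assemble (k , y₁ , y₂) = juxtapose (n ∸ k) k y₁ y₂

  length-decompositions : length decompositions ≡ convSum B A n
  length-decompositions = trans (length-concat (map decompositionsOfSize (upTo n)))
                                (cong sum (trans (sym (map-∘ (upTo n))) (map-cong length-ofSize (upTo n))))
    where
    length-ofSize : ∀ k → length (decompositionsOfSize k) ≡ B (n ∸ k) * A k
    length-ofSize k = trans (length-map _ (cartesianProduct (oneBlockClasses (n ∸ k)) (classes k)))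
                            (trans (length-cartesianProduct (oneBlockClasses (n ∸ k)) (classes k))
                              (cong₂ _*_ (proj₁ (proj₂ (card-B (n ∸ k)))) (proj₁ (proj₂ (card-A k)))))

  Unique-decompositions : Unique decompositions
  Unique-decompositions =
    Unique.concat⁺ (All.map⁺ (All.tabulate λ {k} _ →
                     Unique.map⁺ (cong proj₂) (Unique.cartesianProduct⁺ (proj₁ (proj₂ (proj₂ (card-B (n ∸ k)))))
                                                                        (proj₁ (proj₂ (proj₂ (card-A k)))))))
                   (AllPairs.map⁺ (AllPairs.map disjoint (Unique.upTo⁺ n)))
    where
    disjoint : ∀ {k k′} → k ≢ k′ → Disjoint (decompositionsOfSize k) (decompositionsOfSize k′)
    disjoint k≢k′ (m , m′) with ∈-map⁻ _ m | ∈-map⁻ _ m′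
    ... | _ , _ , refl | _ , _ , refl = k≢k′ refl

  ∈-decompositions⁻ : ∀ {k y₁ y₂} → (k , y₁ , y₂) ∈ decompositions →
                      k < n × TaClass1 (n ∸ k) y₁ × TaClass k y₂
  ∈-decompositions⁻ m with ∈-concat⁻′ (map decompositionsOfSize (upTo n)) m
  ... | _ , m₁ , m₂ with ∈-map⁻ decompositionsOfSize m₂
  ...   | k , k∈upTo , refl with ∈-map⁻ (k ,_) m₁
  ...     | (y₁ , y₂) , m₃ , refl with ∈-cartesianProduct⁻ (oneBlockClasses (n ∸ k)) (classes k) m₃
  ...       | y₁∈ , y₂∈ = ∈-upTo⁻ k∈upTo , to (proj₂ (proj₂ (proj₂ (card-B (n ∸ k)))) y₁) y₁∈ ,
    to (proj₂ (proj₂ (proj₂ (card-A k))) y₂) y₂∈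

  ∈-decompositions⁺ : ∀ {k y₁ y₂} → k < n → TaClass1 (n ∸ k) y₁ → TaClass k y₂ →
                      (k , y₁ , y₂) ∈ decompositions
  ∈-decompositions⁺ {k} {y₁} {y₂} k<n T₁ T₂ =
    ∈-concat⁺′ (∈-map⁺ (k ,_) (∈-cartesianProduct⁺ (from (proj₂ (proj₂ (proj₂ (card-B (n ∸ k)))) y₁) T₁)
                                                    (from (proj₂ (proj₂ (proj₂ (card-A k))) y₂) T₂)))
               (∈-map⁺ decompositionsOfSize (∈-upTo⁺ k<n))

  assemble-injectiveOn : ∀ {t t′} → t ∈ decompositions → t′ ∈ decompositions →
                         assemble t ≡ assemble t′ → t ≡ t′
  assemble-injectiveOn {k , y₁ , y₂} {k′ , y₁′ , y₂′} m m′ eq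
    with ∈-decompositions⁻ m | ∈-decompositions⁻ m′ | <-cmp k k′
  ... | k<n , T₁ , T₂ | k′<n , T₁′ , T₂′ | tri≈ _ refl _
    with juxtapose-injective (proj₁ T₁) (proj₁ T₁′) eq
  ...   | refl , refl = refl
  assemble-injectiveOn m m′ eq | k<n , T₁ , _ | k′<n , T₁′ , _ | tri< k<k′ _ _ =
    ⊥-elim (juxtapose-OneBlock-maximal T₁ (proj₁ T₁′) (m<n⇒0<n∸m k′<n) (∸-monoʳ-< k<k′ (<⇒≤ k′<n)) eq)
  assemble-injectiveOn m m′ eq | k<n , T₁ , _ | k′<n , T₁′ , _ | tri> _ _ k′<k =
    ⊥-elim (juxtapose-OneBlock-maximal T₁′ (proj₁ T₁) (m<n⇒0<n∸m k<n) (∸-monoʳ-< k′<k (<⇒≤ k<n)) (sym eq))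

  ∈-assemble⇔TaClass : 0 < n → ∀ y → y ∈ map assemble decompositions ⇔ TaClass n y
  ∈-assemble⇔TaClass 0<n y = mk⇔ assembled⇒TaClass TaClass⇒assembled
    where
    assembled⇒TaClass : y ∈ map assemble decompositions → TaClass n y
    assembled⇒TaClass m with ∈-map⁻ assemble m
    ... | (k , y₁ , y₂) , m′ , refl with ∈-decompositions⁻ m′
    ...   | k<n , T₁ , T₂ = subst (λ n′ → TaClass n′ (assemble (k , y₁ , y₂))) (m∸n+n≡m (<⇒≤ k<n))
      (TaClass-juxtapose (proj₁ T₁) T₂)
    TaClass⇒assembled : TaClass n y → y ∈ map assemble decompositions
    TaClass⇒assembled T with first-block 0<n T
    ... | c , 0<c , c≤n , y₁ , y₂ , T₁ , T₂ , refl =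
      subst (_∈ map assemble decompositions) (cong (λ c′ → juxtapose c′ (n ∸ c) y₁ y₂) c′≡c)
        (∈-map⁺ assemble (∈-decompositions⁺ (∸-monoʳ-< 0<c c≤n)
                                             (subst (λ c′ → TaClass1 c′ y₁) (sym c′≡c) T₁) T₂))
      where
      c′≡c : n ∸ (n ∸ c) ≡ c
      c′≡c = m∸[m∸n]≡n c≤n

  Card-TaClass : 0 < n → Card (TaClass n) (convSum B A n)
  Card-TaClass 0<n = map assemble decompositions ,
                     trans (length-map assemble decompositions) length-decompositions ,
                     Unique-map-injectiveOn Unique-decompositions assemble-injectiveOn ,
                     ∈-assemble⇔TaClass 0<n

lemma5 : (A B : ℕ → ℕ) → (∀ m → Card (TaClass m) (A m)) → (∀ m → Card (TaClass1 m) (B m))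
    → ∀ n → 0 < n → A n ≡ convSum B A n
lemma5 A B card-A card-B n 0<n = Card-unique (card-A n) (Counting.Card-TaClass card-A card-B n 0<n)
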